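{- For all positive integers $n,m$: $C_n \triangleright C_m$ if and only if $m$ divides $n$; $\widetilde{P_n} \triangleright \widetilde{P_m}$ if and only if $m$ divides $n$; $C_n \triangleright \widetilde{P_m}$ if and only if $2m$ divides $n$; and $\widetilde{P_n} \triangleright C_m$ if and only if $m$ divides $2n$.
   Context: A graph has finite vertex and edge sets; every edge is a normal edge (two distinct end-vertices, adding 1 to each degree), a loop (one vertex, adding 2 to its degree) or a semi-edge (one vertex, adding 1 to its degree); multiple loops, semi-edges and parallel edges are allowed. A graph is simple if it has no loops, semi-edges or parallel normal edges. $C_n$ is the cycle of length $n$ ($C_1$ is a vertex with a loop, $C_2$ two vertices joined by two parallel edges). $\widetilde{P_n}$ is the path on $n$ vertices with one semi-edge added at each of its two terminal vertices (the connected 2-regular graphs are exactly the $C_n$ and the $\widetilde{P_n}$). A covering projection from $G$ to a connected graph $H$ is a pair of surjective maps $f_V:V(G)\to V(H)$, $f_E:E(G)\to E(H)$ with $f_V$ degree preserving, $f_E$ mapping semi-edges onto semi-edges and loops onto loops (normal edges may go to normal edges, loops or semi-edges), $f_E$ incidence preserving, and $f_E$ a local bijection between edge-neighborhoods of each vertex and its image (so the preimage of a loop at $u$ is a disjoint union of cycles spanning $f_V^{ -1}(u)$, the preimage of a semi-edge at $u$ consists of semi-edges and normal edges covering each vertex of $f_V^{ -1}(u)$ exactly once, and the preimage of a normal edge $uv$ is a perfect matching between the two fibers). $A\triangleright B$ means every simple graph covering $A$ also covers $B$. -}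

module Defs where

open import Data.Nat using (ℕ; zero; suc; _+_; _*_; NonZero)
open import Data.Fin using (Fin; zero; suc; inject₁; fromℕ; toℕ; _≟_)
open import Data.Fin.Properties using (toℕ-inject₁)
open import Data.List using (List; map; allFin)
open import Data.Product using (_×_; _,_; ∃; ∃₂)
open import Data.Sum using (_⊎_)
open import Data.Empty using (⊥)
open import Data.Bool using (if_then_else_)
open import Relation.Nullary using (¬_; Dec; yes; no)
open import Relation.Nullary.Decidable using (⌊_⌋)
open import Relation.Binary.PropositionalEquality using (_≡_; _≢_; refl; cong)
open import Data.Nat.Properties using (n<1+n; <-irrefl)
open import Data.Nat.ListAction using (sum)

-- Edges: a normal edge (two end-vertices), a loop (one vertex, adds 2
-- to its degree) or a semi-edge (one vertex, adds 1 to its degree).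

data Shape (V : Set) : Set where
  normal : V → V → Shape V
  loop   : V → Shape V
  semi   : V → Shape V

record Graph : Set where
  field
    nV   : ℕ
    nE   : ℕ
    edge : Fin nE → Shape (Fin nV)
    normal-distinct : ∀ e x y → edge e ≡ normal x y → x ≢ y
open Graph public

[_≡?_] : ∀ {k} → Fin k → Fin k → ℕ
[ x ≡? y ] = if ⌊ x ≟ y ⌋ then 1 else 0

endsAt : ∀ {k} → Shape (Fin k) → Fin k → ℕ
endsAt (normal x y) v = [ x ≡? v ] + [ y ≡? v ]
endsAt (loop x)     v = 2 * [ x ≡? v ]
endsAt (semi x)     v = [ x ≡? v ]

Σ[_] : (n : ℕ) → (Fin n → ℕ) → ℕ
Σ[ n ] f = sum (map f (allFin n))

deg : (G : Graph) → Fin (nV G) → ℕ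
deg G v = Σ[ nE G ] (λ e → endsAt (edge G e) v)

SameEnds : ∀ {k} → Fin k → Fin k → Fin k → Fin k → Set
SameEnds x y x' y' = (x ≡ x' × y ≡ y') ⊎ (x ≡ y' × y ≡ x')

record Simple (G : Graph) : Set where
  field
    all-normal : ∀ e → ∃₂ λ x y → edge G e ≡ normal x y
    no-parallel : ∀ e e' x y x' y' → edge G e ≡ normal x y →
                  edge G e' ≡ normal x' y' → SameEnds x y x' y' → e ≡ e'

-- Incidence preservation of an edge with shape s mapped (via vertex
-- map f) to an edge with shape t; also encodes that semi-edges map
-- only onto semi-edges and loops only onto loops (normal edges may map
-- to normal edges, loops or semi-edges).
Incid : ∀ {k l} → (Fin k → Fin l) → Shape (Fin k) → Shape (Fin l) → Set
Incid f (normal x y) (normal u v) = SameEnds (f x) (f y) u v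
Incid f (normal x y) (loop u)     = f x ≡ u × f y ≡ u
Incid f (normal x y) (semi u)     = f x ≡ u × f y ≡ u
Incid f (loop x)     (loop u)     = f x ≡ u
Incid f (loop x)     _            = ⊥
Incid f (semi x)     (semi u)     = f x ≡ u
Incid f (semi x)     _            = ⊥

record Covering (G H : Graph) : Set where
  field
    fV : Fin (nV G) → Fin (nV H)
    fE : Fin (nE G) → Fin (nE H)
    fV-surj : ∀ u → ∃ λ x → fV x ≡ u
    fE-surj : ∀ h → ∃ λ e → fE e ≡ h
    deg-pres : ∀ x → deg G x ≡ deg H (fV x)
    incid : ∀ e → Incid fV (edge G e) (edge H (fE e))
    -- local bijection between edge-neighbourhoods (counted by
    -- edge-ends): for every vertex x of G and every edge h of H, the
    -- number of edge-ends at x of edges mapped to h equals the number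
    -- of edge-ends of h at fV x.
    local-bij : ∀ x h →
      Σ[ nE G ] (λ e → if ⌊ fE e ≟ h ⌋ then endsAt (edge G e) x else 0)
        ≡ endsAt (edge H h) (fV x)

_▷_ : Graph → Graph → Set
A ▷ B = ∀ (G : Graph) → Simple G → Covering G A → Covering G B

-- The cycle C_n (n ≥ 1).  C_1: a vertex with a loop; C_2: two vertices
-- with two parallel edges; C_{k+2}: vertices 0..k+1, edge 0 joins 0 and
-- k+1, edge (suc i) joins i and i+1.

private
  inj≢suc : ∀ {k} (i : Fin k) → inject₁ i ≢ suc i
  inj≢suc i eq = <-irrefl (trans' (cong toℕ eq)) (n<1+n (toℕ i))
    where
      trans' : toℕ (inject₁ i) ≡ suc (toℕ i) → toℕ i ≡ suc (toℕ i)
      trans' p rewrite toℕ-inject₁ i = p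

cycEdge : (k : ℕ) → Fin (suc (suc k)) → Shape (Fin (suc (suc k)))
cycEdge k zero    = normal zero (fromℕ (suc k))
cycEdge k (suc i) = normal (inject₁ i) (suc i)

cycDistinct : ∀ k e x y → cycEdge k e ≡ normal x y → x ≢ y
cycDistinct k zero    x y refl ()
cycDistinct k (suc i) x y refl = inj≢suc i

C : (n : ℕ) → .{{NonZero n}} → Graph
C (suc zero) = record
  { nV = 1 ; nE = 1 ; edge = λ _ → loop zero
  ; normal-distinct = λ { _ _ _ () } }
C (suc (suc k)) = record
  { nV = suc (suc k) ; nE = suc (suc k) ; edge = cycEdge k
  ; normal-distinct = cycDistinct k }

-- The path P̃_n (n ≥ 1) on vertices 0..n-1 with a semi-edge at each of
-- its two terminal vertices (for n = 1: two semi-edges at one vertex).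

pathEdge : (k : ℕ) → Fin (suc (suc k)) → Shape (Fin (suc k))
pathEdge k zero          = semi zero
pathEdge k (suc zero)    = semi (fromℕ k)
pathEdge k (suc (suc i)) = normal (inject₁ i) (suc i)

pathDistinct : ∀ k e x y → pathEdge k e ≡ normal x y → x ≢ y
pathDistinct k (suc (suc i)) x y refl = inj≢suc i

P̃ : (n : ℕ) → .{{NonZero n}} → Graph
P̃ (suc k) = record
  { nV = suc k ; nE = suc (suc k) ; edge = pathEdge k
  ; normal-distinct = pathDistinct k }

{-# OPTIONS --safe #-}
module Submission where

-- Only if: the cycle C (x (2m + 1)) is simple and covers C x; take x = n, or x = 2n and go on to
-- P̃ n through C 2n.  In a covering by a simple graph, the fibres over the two ends of a normal
-- edge have the size of the edge's fibre, and the fibre over a semi-edge's vertex has twice that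
-- size; so a simple graph covering C m has a multiple of m vertices, and one covering P̃ m a
-- multiple of 2m.  Since 2m + 1 ≡ 1 modulo m, the divisibility descends from x (2m + 1) to x.
-- If: C N covers C m when m ∣ N (reduce modulo m), C 2m covers P̃ m (fold the cycle in half), and
-- every simple graph G covering P̃ m covers C 2m: the edges of G over path edges of even, resp.
-- odd, position form two perfect matchings, so G is bipartite, and a 2-colouring corrected by
-- the parity of the image vertex says on which half of C 2m each vertex of G lies.

open import Defs
open import Data.Nat
  using (ℕ; zero; suc; _+_; _*_; _∸_; _⊓_; pred; _≤_; _<_; _<?_; z≤n; s≤s; s≤s⁻¹; NonZero; >-nonZero⁻¹; _%_; _/_)
open import Data.Nat.Properties hiding (_≟_)
open import Data.Nat.Properties using () renaming (_≟_ to _≟ℕ_)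
open import Data.Nat.DivMod
  using (m%n<n; n%n≡0; m<n⇒m%n≡m; %-distribˡ-+; m%n%n≡m%n; [m+n]%n≡m%n; m∣n⇒o%n%m≡o%m; m≡m%n+[m/n]*n)
open import Data.Nat.Divisibility
  using (_∣_; divides; ∣⇒≤; ∣-refl; n∣m*n; m∣m*n; ∣n⇒∣m*n; ∣m+n∣m⇒∣n; *-cancelˡ-∣; *-monoʳ-∣)
import Data.Nat.ListAction as List
open import Algebra.Properties.Semiring.Sum +-*-semiring
  using (sum; sum-syntax; sum-cong-≗; ∑-distrib-+; ∑-comm; *-distribˡ-sum)
open import Data.Fin using (Fin; zero; suc; _≟_; toℕ; fromℕ; fromℕ<; inject₁)
open import Data.Fin.Properties
  using (toℕ-injective; toℕ-fromℕ<; toℕ-fromℕ; toℕ-inject₁; toℕ<n; pigeonhole)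
  renaming (suc-injective to Fin-suc-injective)
open import Data.List using (map; tabulate)
open import Data.Product using (_×_; _,_; ∃; ∃₂; proj₁; proj₂)
open import Data.Sum using (_⊎_; inj₁; inj₂)
open import Data.Empty using (⊥-elim)
open import Data.Bool using (Bool; true; false; not; _xor_; if_then_else_)
open import Data.Bool.Properties using (not-involutive; not-¬; not-distribˡ-xor; not-distribʳ-xor)
open import Relation.Nullary using (Dec; yes; no)
open import Relation.Nullary.Decidable using (⌊_⌋)
open import Relation.Binary.PropositionalEquality
open import Function using (_∘_; id)
open import Function.Bundles using (_⇔_; mk⇔)

-- Finite sums

δ : ∀ {k} → Fin k → Fin k → ℕ → ℕ
δ x y X = if ⌊ x ≟ y ⌋ then X else 0

δ-self : ∀ {k} (x : Fin k) X → δ x x X ≡ X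
δ-self x X with x ≟ x
... | yes _ = refl
... | no x≢x = ⊥-elim (x≢x refl)

δ-≡ : ∀ {k} {x y : Fin k} X → x ≡ y → δ x y X ≡ X
δ-≡ {x = x} X refl = δ-self x X

δ-≢ : ∀ {k} (x y : Fin k) X → x ≢ y → δ x y X ≡ 0
δ-≢ x y X x≢y with x ≟ y
... | yes x≡y = ⊥-elim (x≢y x≡y)
... | no _ = refl

if-cong : ∀ {P Q : Set} (p : Dec P) (q : Dec Q) X → (P → Q) → (Q → P) →
          (if ⌊ p ⌋ then X else 0) ≡ (if ⌊ q ⌋ then X else 0)
if-cong (yes _) (yes _) X to from = refl
if-cong (no _)  (no _)  X to from = refl
if-cong (yes p) (no ¬q) X to from = ⊥-elim (¬q (to p))
if-cong (no ¬p) (yes q) X to from = ⊥-elim (¬p (from q))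

δ-iff : ∀ {k l} (x y : Fin k) (x′ y′ : Fin l) X →
        (x ≡ y → x′ ≡ y′) → (x′ ≡ y′ → x ≡ y) → δ x y X ≡ δ x′ y′ X
δ-iff x y x′ y′ = if-cong (x ≟ y) (x′ ≟ y′)

δ-sym : ∀ {k} (x y : Fin k) X → δ x y X ≡ δ y x X
δ-sym x y X = δ-iff x y y x X sym sym

δ-positive : ∀ {k} (x y : Fin k) X → 1 ≤ δ x y X → x ≡ y × 1 ≤ X
δ-positive x y X p with x ≟ y
... | yes x≡y = x≡y , p
... | no _    = ⊥-elim (1+n≰n p)

δ-comm : ∀ {k l} (a b : Fin k) (c d : Fin l) X → δ a b (δ c d X) ≡ δ c d (δ a b X)
δ-comm a b c d X with a ≟ b | c ≟ d
... | yes _ | yes _ = refl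
... | yes _ | no _  = refl
... | no _  | yes _ = refl
... | no _  | no _  = refl

δ-distrib-+ : ∀ {k} (a b : Fin k) X Y → δ a b (X + Y) ≡ δ a b X + δ a b Y
δ-distrib-+ a b X Y with a ≟ b
... | yes _ = refl
... | no _  = refl

Σ≡sum : ∀ n (f : Fin n → ℕ) → Σ[ n ] f ≡ sum f
Σ≡sum n f = go n id
  where
  go : ∀ {A : Set} k (g : Fin k → A) {f : A → ℕ} → List.sum (map f (tabulate g)) ≡ sum (f ∘ g)
  go zero    g = refl
  go (suc k) g {f} = cong (f (g zero) +_) (go k (g ∘ suc))

sum-const : ∀ n c → sum {n} (λ _ → c) ≡ n * c
sum-const zero    c = refl
sum-const (suc n) c = cong (c +_) (sum-const n c)

sum-zero : ∀ n → sum {n} (λ _ → 0) ≡ 0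
sum-zero n = trans (sum-const n 0) (*-zeroʳ n)

sum-δ : ∀ {n} (a : Fin n) (g : Fin n → ℕ) → sum (λ i → δ i a (g i)) ≡ g a
sum-δ {suc n} zero g = trans (cong₂ _+_ (δ-self {suc n} zero (g zero))
  (trans (sum-cong-≗ {n} (λ i → δ-≢ (suc i) zero (g (suc i)) λ ())) (sum-zero n))) (+-identityʳ _)
sum-δ {suc n} (suc a) g = cong₂ _+_ (δ-≢ zero (suc a) (g zero) λ ())
  (trans (sum-cong-≗ {n} (λ i → δ-iff (suc i) (suc a) i a _ Fin-suc-injective (cong suc)))
         (sum-δ a (g ∘ suc)))

sum-δ′ : ∀ {n} (a : Fin n) (g : Fin n → ℕ) → sum (λ i → δ a i (g i)) ≡ g a
sum-δ′ a g = trans (sum-cong-≗ (λ i → δ-sym a i (g i))) (sum-δ a g)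

δ-sum : ∀ {k n} (a b : Fin k) (f : Fin n → ℕ) → δ a b (sum f) ≡ sum (λ i → δ a b (f i))
δ-sum {n = n} a b f with a ≟ b
... | yes _ = refl
... | no _  = sym (sum-zero n)

term≤sum : ∀ {n} (f : Fin n → ℕ) i → f i ≤ sum f
term≤sum f zero    = m≤m+n _ _
term≤sum f (suc i) = ≤-trans (term≤sum (f ∘ suc) i) (m≤n+m _ _)

sum-positive : ∀ {n} (f : Fin n → ℕ) → 1 ≤ sum f → ∃ λ i → 1 ≤ f i
sum-positive {suc n} f p with f zero in eq
... | suc _ = zero , subst (1 ≤_) (sym eq) (s≤s z≤n)
... | zero with sum-positive (f ∘ suc) p
...   | i , q = suc i , q

sum≤1-unique : ∀ {n} (f : Fin n → ℕ) → sum f ≤ 1 → ∀ i j → 1 ≤ f i → 1 ≤ f j → i ≡ j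
sum≤1-unique f le zero    zero    p q = refl
sum≤1-unique f le zero    (suc j) p q =
  ⊥-elim (1+n≰n (≤-trans (+-mono-≤ p (≤-trans q (term≤sum (f ∘ suc) j))) le))
sum≤1-unique f le (suc i) zero    p q =
  ⊥-elim (1+n≰n (≤-trans (+-mono-≤ q (≤-trans p (term≤sum (f ∘ suc) i))) le))
sum≤1-unique f le (suc i) (suc j) p q =
  cong suc (sum≤1-unique (f ∘ suc) (≤-trans (m≤n+m _ _) le) i j p q)

sum≤1-match : ∀ {n} (A B : Fin n → ℕ) → sum A ≡ sum B → sum B ≤ 1 →
              (∀ i → 1 ≤ A i → 1 ≤ B i) → ∀ i → A i ≡ B i
sum≤1-match A B eq le supp i
  with n≤1⇒n≡0∨n≡1 (≤-trans (term≤sum A i) (subst (_≤ 1) (sym eq) le))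
     | n≤1⇒n≡0∨n≡1 (≤-trans (term≤sum B i) le)
... | inj₁ Ai≡0 | inj₁ Bi≡0 = trans Ai≡0 (sym Bi≡0)
... | inj₂ Ai≡1 | inj₂ Bi≡1 = trans Ai≡1 (sym Bi≡1)
... | inj₂ Ai≡1 | inj₁ Bi≡0 = ⊥-elim (1+n≰n (subst (1 ≤_) Bi≡0 (supp i (≤-reflexive (sym Ai≡1)))))
... | inj₁ Ai≡0 | inj₂ Bi≡1
  with sum-positive A (subst (1 ≤_) (sym eq) (≤-trans (≤-reflexive (sym Bi≡1)) (term≤sum B i)))
...   | j , 1≤Aj = ⊥-elim (1+n≰n (subst (1 ≤_) (trans (cong A j≡i) Ai≡0) 1≤Aj))
  where
  j≡i : j ≡ i
  j≡i = sum≤1-unique B le j i (supp j 1≤Aj) (≤-reflexive (sym Bi≡1))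

-- Coverings

LocalBij : (G H : Graph) → (Fin (nV G) → Fin (nV H)) → (Fin (nE G) → Fin (nE H)) → Set
LocalBij G H fV fE =
  ∀ x h → ∑[ e < nE G ] δ (fE e) h (endsAt (edge G e) x) ≡ endsAt (edge H h) (fV x)

sum-partition : ∀ {n m} (f : Fin n → Fin m) (X : Fin n → ℕ) →
                sum X ≡ ∑[ h < m ] ∑[ e < n ] δ (f e) h (X e)
sum-partition {n} {m} f X = sym (trans (∑-comm (λ h e → δ (f e) h (X e)))
                                       (sum-cong-≗ {n} (λ e → sum-δ′ (f e) (λ _ → X e))))

sum-partition-∘ : ∀ {n m l} (f : Fin n → Fin m) (g : Fin m → Fin l) (X : Fin n → ℕ) h →
  ∑[ e < n ] δ (g (f e)) h (X e) ≡ ∑[ h′ < m ] δ (g h′) h (∑[ e < n ] δ (f e) h′ (X e))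
sum-partition-∘ {n} {m} f g X h = sym (begin
    ∑[ h′ < m ] δ (g h′) h (∑[ e < n ] δ (f e) h′ (X e))
  ≡⟨ sum-cong-≗ {m} (λ h′ → δ-sum (g h′) h (λ e → δ (f e) h′ (X e))) ⟩
    ∑[ h′ < m ] ∑[ e < n ] δ (g h′) h (δ (f e) h′ (X e))
  ≡⟨ ∑-comm (λ h′ e → δ (g h′) h (δ (f e) h′ (X e))) ⟩
    ∑[ e < n ] ∑[ h′ < m ] δ (g h′) h (δ (f e) h′ (X e))
  ≡⟨ sum-cong-≗ {n} (λ e → sum-cong-≗ {m} (λ h′ → δ-comm (g h′) h (f e) h′ (X e))) ⟩
    ∑[ e < n ] ∑[ h′ < m ] δ (f e) h′ (δ (g h′) h (X e))
  ≡⟨ sum-cong-≗ {n} (λ e → sum-δ′ (f e) (λ h′ → δ (g h′) h (X e))) ⟩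
    ∑[ e < n ] δ (g (f e)) h (X e)
  ∎)
  where open ≡-Reasoning

deg≡sum : ∀ G x → deg G x ≡ ∑[ e < nE G ] endsAt (edge G e) x
deg≡sum G x = Σ≡sum (nE G) _

covering : ∀ {G H} (fV : Fin (nV G) → Fin (nV H)) (fE : Fin (nE G) → Fin (nE H)) →
  (∀ u → ∃ λ x → fV x ≡ u) → (∀ h → ∃ λ e → fE e ≡ h) →
  (∀ e → Incid fV (edge G e) (edge H (fE e))) → LocalBij G H fV fE → Covering G H
covering {G} {H} fV fE fV-surj fE-surj incid lb = record
  { fV = fV ; fE = fE ; fV-surj = fV-surj ; fE-surj = fE-surj
  ; deg-pres = deg-pres ; incid = incid
  ; local-bij = λ x h → trans (Σ≡sum (nE G) _) (lb x h) }
  where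
  deg-pres : ∀ x → deg G x ≡ deg H (fV x)
  deg-pres x = begin
      deg G x
    ≡⟨ deg≡sum G x ⟩
      ∑[ e < nE G ] endsAt (edge G e) x
    ≡⟨ sum-partition fE _ ⟩
      ∑[ h < nE H ] ∑[ e < nE G ] δ (fE e) h (endsAt (edge G e) x)
    ≡⟨ sum-cong-≗ {nE H} (lb x) ⟩
      ∑[ h < nE H ] endsAt (edge H h) (fV x)
    ≡⟨ deg≡sum H (fV x) ⟨
      deg H (fV x)
    ∎
    where open ≡-Reasoning

localBij : ∀ {G H} (c : Covering G H) → LocalBij G H (Covering.fV c) (Covering.fE c)
localBij {G} c x h = trans (sym (Σ≡sum (nE G) _)) (Covering.local-bij c x h)

SameEnds-swapˡ : ∀ {k} {a b c d : Fin k} → SameEnds a b c d → SameEnds b a c d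
SameEnds-swapˡ (inj₁ (p , q)) = inj₂ (q , p)
SameEnds-swapˡ (inj₂ (p , q)) = inj₁ (q , p)

SameEnds-swapʳ : ∀ {k} {a b c d : Fin k} → SameEnds a b c d → SameEnds a b d c
SameEnds-swapʳ (inj₁ (p , q)) = inj₂ (p , q)
SameEnds-swapʳ (inj₂ (p , q)) = inj₁ (p , q)

SameEnds-sym : ∀ {k} {a b c d : Fin k} → SameEnds a b c d → SameEnds c d a b
SameEnds-sym (inj₁ (p , q)) = inj₁ (sym p , sym q)
SameEnds-sym (inj₂ (p , q)) = inj₂ (sym q , sym p)

SameEnds-trans : ∀ {k} {a b c d e f : Fin k} → SameEnds a b c d → SameEnds c d e f → SameEnds a b e f
SameEnds-trans (inj₁ (p , q)) (inj₁ (r , s)) = inj₁ (trans p r , trans q s)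
SameEnds-trans (inj₁ (p , q)) (inj₂ (r , s)) = inj₂ (trans p r , trans q s)
SameEnds-trans (inj₂ (p , q)) (inj₁ (r , s)) = inj₂ (trans p s , trans q r)
SameEnds-trans (inj₂ (p , q)) (inj₂ (r , s)) = inj₁ (trans p s , trans q r)

SameEnds-map : ∀ {k l} (f : Fin k → Fin l) {a b c d : Fin k} →
               SameEnds a b c d → SameEnds (f a) (f b) (f c) (f d)
SameEnds-map f (inj₁ (p , q)) = inj₁ (cong f p , cong f q)
SameEnds-map f (inj₂ (p , q)) = inj₂ (cong f p , cong f q)

Incid-∘ : ∀ {k l m} (f : Fin k → Fin l) (g : Fin l → Fin m) s t u →
          Incid f s t → Incid g t u → Incid (g ∘ f) s u
Incid-∘ f g (normal a b) (normal c d) (normal x y) i j = SameEnds-trans (SameEnds-map g i) j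
Incid-∘ f g (normal a b) (normal c d) (loop x) (inj₁ (p , q)) (r , s) = trans (cong g p) r , trans (cong g q) s
Incid-∘ f g (normal a b) (normal c d) (loop x) (inj₂ (p , q)) (r , s) = trans (cong g p) s , trans (cong g q) r
Incid-∘ f g (normal a b) (normal c d) (semi x) (inj₁ (p , q)) (r , s) = trans (cong g p) r , trans (cong g q) s
Incid-∘ f g (normal a b) (normal c d) (semi x) (inj₂ (p , q)) (r , s) = trans (cong g p) s , trans (cong g q) r
Incid-∘ f g (normal a b) (loop c) (loop x) (p , q) r = trans (cong g p) r , trans (cong g q) r
Incid-∘ f g (normal a b) (semi c) (semi x) (p , q) r = trans (cong g p) r , trans (cong g q) r
Incid-∘ f g (loop a) (loop c) (loop x) p r = trans (cong g p) r
Incid-∘ f g (semi a) (semi c) (semi x) p r = trans (cong g p) r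

∘-surjective : ∀ {A B C : Set} {f : A → B} {g : B → C} →
  (∀ b → ∃ λ a → f a ≡ b) → (∀ c → ∃ λ b → g b ≡ c) → ∀ c → ∃ λ a → g (f a) ≡ c
∘-surjective f-surj g-surj c with g-surj c
... | b , refl with f-surj b
...   | a , refl = a , refl

_∘Cov_ : ∀ {G H K} → Covering H K → Covering G H → Covering G K
_∘Cov_ {G} {H} {K} d c =
  covering (D.fV ∘ C.fV) (D.fE ∘ C.fE)
    (∘-surjective C.fV-surj D.fV-surj) (∘-surjective C.fE-surj D.fE-surj)
    (λ e → Incid-∘ C.fV D.fV _ _ _ (C.incid e) (D.incid (C.fE e))) lb
  where
  module C = Covering c
  module D = Covering d
  lb : LocalBij G K (D.fV ∘ C.fV) (D.fE ∘ C.fE)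
  lb x h = begin
      ∑[ e < nE G ] δ (D.fE (C.fE e)) h (endsAt (edge G e) x)
    ≡⟨ sum-partition-∘ C.fE D.fE _ h ⟩
      ∑[ h′ < nE H ] δ (D.fE h′) h (∑[ e < nE G ] δ (C.fE e) h′ (endsAt (edge G e) x))
    ≡⟨ sum-cong-≗ {nE H} (λ h′ → cong (δ (D.fE h′) h) (localBij c x h′)) ⟩
      ∑[ h′ < nE H ] δ (D.fE h′) h (endsAt (edge H h′) (C.fV x))
    ≡⟨ localBij d (C.fV x) h ⟩
      endsAt (edge K h) (D.fV (C.fV x))
    ∎
    where open ≡-Reasoning

LocalBij-lift-edge : ∀ {G H fV fE} → LocalBij G H fV fE → ∀ x h →
  1 ≤ endsAt (edge H h) (fV x) → ∃ λ e → fE e ≡ h × 1 ≤ endsAt (edge G e) x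
LocalBij-lift-edge {G} {fE = fE} lb x h p
  with sum-positive (λ e → δ (fE e) h (endsAt (edge G e) x)) (subst (1 ≤_) (sym (lb x h)) p)
... | e , q = e , δ-positive (fE e) h _ q

LocalBij-unique-edge : ∀ {G H fV fE} → LocalBij G H fV fE → ∀ x h → endsAt (edge H h) (fV x) ≤ 1 →
  ∀ e e′ → fE e ≡ h → 1 ≤ endsAt (edge G e) x → fE e′ ≡ h → 1 ≤ endsAt (edge G e′) x → e ≡ e′
LocalBij-unique-edge {G} {fE = fE} lb x h ≤1 e e′ fEe≡h p fEe′≡h p′ =
  sum≤1-unique (λ e → δ (fE e) h (endsAt (edge G e) x)) (subst (_≤ 1) (sym (lb x h)) ≤1) e e′
    (subst (1 ≤_) (sym (δ-≡ _ fEe≡h)) p) (subst (1 ≤_) (sym (δ-≡ _ fEe′≡h)) p′)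

-- Fibre sizes

[≡?]-positive : ∀ {k} (a b : Fin k) → 1 ≤ [ a ≡? b ] → a ≡ b
[≡?]-positive a b p = proj₁ (δ-positive a b 1 p)

[≡?]*-δ : ∀ {k l} (a b : Fin k) (c d : Fin l) Y → [ a ≡? b ] * δ c d Y ≡ δ c d ([ a ≡? b ] * Y)
[≡?]*-δ a b c d Y with c ≟ d
... | yes _ = refl
... | no _  = *-zeroʳ [ a ≡? b ]

[≡?]*≡δ : ∀ {k} (a b : Fin k) Y → [ a ≡? b ] * Y ≡ δ a b Y
[≡?]*≡δ a b Y with a ≟ b
... | yes _ = +-identityʳ Y
... | no _  = refl

[≡?]*-endsAt : ∀ {k} (a b : Fin k) s → [ a ≡? b ] * endsAt s a ≡ [ a ≡? b ] * endsAt s b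
[≡?]*-endsAt a b s with a ≟ b
... | yes refl = refl
... | no _     = refl

SameEnds-[≡?] : ∀ {k} {x y u v : Fin k} → SameEnds x y u v → ∀ w →
                [ x ≡? w ] + [ y ≡? w ] ≡ [ u ≡? w ] + [ v ≡? w ]
SameEnds-[≡?] (inj₁ (refl , refl)) w = refl
SameEnds-[≡?] {x = x} {y} (inj₂ (refl , refl)) w = +-comm [ x ≡? w ] [ y ≡? w ]

[≡?]-endpoint : ∀ {k} {u v w : Fin k} → u ≢ v → w ≡ u ⊎ w ≡ v → [ u ≡? w ] + [ v ≡? w ] ≡ 1
[≡?]-endpoint {u = u} {v} u≢v (inj₁ refl) = cong₂ _+_ (δ-self u 1) (δ-≢ v u 1 (u≢v ∘ sym))
[≡?]-endpoint {u = u} {v} u≢v (inj₂ refl) = cong₂ _+_ (δ-≢ u v 1 u≢v) (δ-self v 1)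

-- Double counting the ends over u of the edges over h, with local bijectivity at each x over u.
module FibreCount {G H : Graph} (simple : Simple G) (cov : Covering G H) where
  open Covering cov using (fV; fE; incid)

  fibre : Fin (nV H) → ℕ
  fibre u = ∑[ x < nV G ] [ fV x ≡? u ]

  edgeFibre : Fin (nE H) → ℕ
  edgeFibre h = ∑[ e < nE G ] [ fE e ≡? h ]

  endsOver : Fin (nE G) → Fin (nV H) → ℕ
  endsOver e u = ∑[ x < nV G ] ([ fV x ≡? u ] * endsAt (edge G e) x)

  nV≡∑fibre : nV G ≡ ∑[ u < nV H ] fibre u
  nV≡∑fibre = trans (sym (trans (sum-const (nV G) 1) (*-identityʳ (nV G))))
                    (sum-partition fV (λ _ → 1))

  fibre*endsAt : ∀ u h → fibre u * endsAt (edge H h) u ≡ ∑[ e < nE G ] δ (fE e) h (endsOver e u)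
  fibre*endsAt u h = begin
      fibre u * endsAt (edge H h) u
    ≡⟨ *-comm (fibre u) _ ⟩
      endsAt (edge H h) u * fibre u
    ≡⟨ *-distribˡ-sum (endsAt (edge H h) u) (λ x → [ fV x ≡? u ]) ⟩
      ∑[ x < nV G ] (endsAt (edge H h) u * [ fV x ≡? u ])
    ≡⟨ sum-cong-≗ {nV G} (λ x → trans (*-comm _ [ fV x ≡? u ])
                                       (sym ([≡?]*-endsAt (fV x) u (edge H h)))) ⟩
      ∑[ x < nV G ] ([ fV x ≡? u ] * endsAt (edge H h) (fV x))
    ≡⟨ sum-cong-≗ {nV G} (λ x → cong ([ fV x ≡? u ] *_) (sym (localBij cov x h))) ⟩
      ∑[ x < nV G ] ([ fV x ≡? u ] * ∑[ e < nE G ] δ (fE e) h (endsAt (edge G e) x))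
    ≡⟨ sum-cong-≗ {nV G} (λ x → *-distribˡ-sum [ fV x ≡? u ] (λ e → δ (fE e) h (endsAt (edge G e) x)))
     ⟩
      ∑[ x < nV G ] ∑[ e < nE G ] ([ fV x ≡? u ] * δ (fE e) h (endsAt (edge G e) x))
    ≡⟨ sum-cong-≗ {nV G} (λ x → sum-cong-≗ {nE G} (λ e → [≡?]*-δ (fV x) u (fE e) h _)) ⟩
      ∑[ x < nV G ] ∑[ e < nE G ] δ (fE e) h ([ fV x ≡? u ] * endsAt (edge G e) x)
    ≡⟨ ∑-comm (λ x e → δ (fE e) h ([ fV x ≡? u ] * endsAt (edge G e) x)) ⟩
      ∑[ e < nE G ] ∑[ x < nV G ] δ (fE e) h ([ fV x ≡? u ] * endsAt (edge G e) x)
    ≡⟨ sum-cong-≗ {nE G} (λ e → sym (δ-sum (fE e) h (λ x → [ fV x ≡? u ] * endsAt (edge G e) x))) ⟩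
      ∑[ e < nE G ] δ (fE e) h (endsOver e u)
    ∎
    where open ≡-Reasoning

  endsOver-normal : ∀ e u a b → edge G e ≡ normal a b → endsOver e u ≡ [ fV a ≡? u ] + [ fV b ≡? u ]
  endsOver-normal e u a b eq = begin
      ∑[ x < nV G ] ([ fV x ≡? u ] * endsAt (edge G e) x)
    ≡⟨ sum-cong-≗ {nV G} (λ x → cong (λ s → [ fV x ≡? u ] * endsAt s x) eq) ⟩
      ∑[ x < nV G ] ([ fV x ≡? u ] * ([ a ≡? x ] + [ b ≡? x ]))
    ≡⟨ sum-cong-≗ {nV G} (λ x → *-distribˡ-+ [ fV x ≡? u ] [ a ≡? x ] [ b ≡? x ]) ⟩
      ∑[ x < nV G ] ([ fV x ≡? u ] * [ a ≡? x ] + [ fV x ≡? u ] * [ b ≡? x ])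
    ≡⟨ ∑-distrib-+ (λ x → [ fV x ≡? u ] * [ a ≡? x ]) (λ x → [ fV x ≡? u ] * [ b ≡? x ]) ⟩
      ∑[ x < nV G ] ([ fV x ≡? u ] * [ a ≡? x ]) + ∑[ x < nV G ] ([ fV x ≡? u ] * [ b ≡? x ])
    ≡⟨ cong₂ _+_ (picks a) (picks b) ⟩
      [ fV a ≡? u ] + [ fV b ≡? u ]
    ∎
    where
    open ≡-Reasoning
    picks : ∀ c → ∑[ x < nV G ] ([ fV x ≡? u ] * [ c ≡? x ]) ≡ [ fV c ≡? u ]
    picks c = trans (sum-cong-≗ {nV G} (λ x → trans (*-comm [ fV x ≡? u ] [ c ≡? x ]) ([≡?]*≡δ c x _)))
                    (sum-δ′ c (λ x → [ fV x ≡? u ]))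

  private
    incid-at : ∀ e {a b} → edge G e ≡ normal a b → Incid fV (normal a b) (edge H (fE e))
    incid-at e eq = subst (λ s → Incid fV s (edge H (fE e))) eq (incid e)

  endsOver-over-normal : ∀ e {u v} → edge H (fE e) ≡ normal u v → ∀ w →
                         endsOver e w ≡ [ u ≡? w ] + [ v ≡? w ]
  endsOver-over-normal e eqH w with Simple.all-normal simple e
  ... | a , b , eq = trans (endsOver-normal e w a b eq)
                           (SameEnds-[≡?] (subst (Incid fV (normal a b)) eqH (incid-at e eq)) w)

  endsOver-over-semi : ∀ e {u} → edge H (fE e) ≡ semi u → endsOver e u ≡ 2
  endsOver-over-semi e {u} eqH with Simple.all-normal simple e
  ... | a , b , eq with subst (Incid fV (normal a b)) eqH (incid-at e eq)
  ...   | fVa≡u , fVb≡u = trans (endsOver-normal e u a b eq) (cong₂ _+_ (δ-≡ 1 fVa≡u) (δ-≡ 1 fVb≡u))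

  fibre≡*edgeFibre : ∀ u h c → endsAt (edge H h) u ≡ 1 →
                     (∀ e → fE e ≡ h → endsOver e u ≡ c) → fibre u ≡ c * edgeFibre h
  fibre≡*edgeFibre u h c ends≡1 endsOver≡c = begin
      fibre u
    ≡⟨ *-identityʳ (fibre u) ⟨
      fibre u * 1
    ≡⟨ cong (fibre u *_) ends≡1 ⟨
      fibre u * endsAt (edge H h) u
    ≡⟨ fibre*endsAt u h ⟩
      ∑[ e < nE G ] δ (fE e) h (endsOver e u)
    ≡⟨ sum-cong-≗ {nE G} term ⟩
      ∑[ e < nE G ] (c * [ fE e ≡? h ])
    ≡⟨ *-distribˡ-sum c (λ e → [ fE e ≡? h ]) ⟨
      c * edgeFibre h
    ∎
    where
    open ≡-Reasoning
    term : ∀ e → δ (fE e) h (endsOver e u) ≡ c * [ fE e ≡? h ]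
    term e with fE e ≟ h
    ... | yes fEe≡h = trans (endsOver≡c e fEe≡h) (sym (*-identityʳ c))
    ... | no _      = sym (*-zeroʳ c)

  fibre-normal : ∀ h {u v} w → edge H h ≡ normal u v → w ≡ u ⊎ w ≡ v → fibre w ≡ edgeFibre h
  fibre-normal h {u} {v} w eqH w∈uv =
    trans (fibre≡*edgeFibre w h 1 ends≡1 over≡1) (*-identityˡ (edgeFibre h))
    where
    u≢v : u ≢ v
    u≢v = normal-distinct H h u v eqH
    ends≡1 : endsAt (edge H h) w ≡ 1
    ends≡1 rewrite eqH = [≡?]-endpoint u≢v w∈uv
    over≡1 : ∀ e → fE e ≡ h → endsOver e w ≡ 1
    over≡1 e refl = trans (endsOver-over-normal e eqH w) ([≡?]-endpoint u≢v w∈uv)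

  fibre-semi : ∀ h {u} → edge H h ≡ semi u → fibre u ≡ 2 * edgeFibre h
  fibre-semi h {u} eqH = fibre≡*edgeFibre u h 2 ends≡1 (λ { e refl → endsOver-over-semi e eqH })
    where
    ends≡1 : endsAt (edge H h) u ≡ 1
    ends≡1 rewrite eqH = δ-self u 1

chain-constant : ∀ {k} (F : Fin (suc k) → ℕ) → (∀ i → F (suc i) ≡ F (inject₁ i)) → ∀ j → F j ≡ F zero
chain-constant         F step zero    = refl
chain-constant {suc k} F step (suc i) = trans (step i) (chain-constant (F ∘ inject₁) (step ∘ inject₁) i)

sum-chain : ∀ {k} (F : Fin (suc k) → ℕ) → (∀ i → F (suc i) ≡ F (inject₁ i)) →
            ∑[ j < suc k ] F j ≡ suc k * F zero
sum-chain {k} F step = trans (sum-cong-≗ {suc k} (chain-constant F step)) (sum-const (suc k) (F zero))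

covers-C⇒∣nV : ∀ {G} → Simple G → ∀ m .{{_ : NonZero m}} → Covering G (C m) → m ∣ nV G
covers-C⇒∣nV {G} simple 1 cov = divides (nV G) (sym (*-identityʳ (nV G)))
covers-C⇒∣nV {G} simple (suc (suc k)) cov =
  divides (fibre zero) (trans nV≡∑fibre (trans (sum-chain fibre step) (*-comm (suc (suc k)) (fibre zero))))
  where
  open FibreCount simple cov
  step : ∀ i → fibre (suc i) ≡ fibre (inject₁ i)
  step i = trans (fibre-normal (suc i) (suc i) refl (inj₂ refl))
                 (sym (fibre-normal (suc i) (inject₁ i) refl (inj₁ refl)))

covers-P̃⇒2*∣nV : ∀ {G} → Simple G → ∀ m .{{_ : NonZero m}} → Covering G (P̃ m) → 2 * m ∣ nV G
covers-P̃⇒2*∣nV {G} simple (suc k) cov = divides (edgeFibre zero) (begin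
    nV G                               ≡⟨ nV≡∑fibre ⟩
    ∑[ u < suc k ] fibre u             ≡⟨ sum-chain fibre step ⟩
    suc k * fibre zero                 ≡⟨ cong (suc k *_) (fibre-semi zero refl) ⟩
    suc k * (2 * edgeFibre zero)       ≡⟨ *-assoc (suc k) 2 (edgeFibre zero) ⟨
    suc k * 2 * edgeFibre zero         ≡⟨ *-comm (suc k * 2) (edgeFibre zero) ⟩
    edgeFibre zero * (suc k * 2)       ≡⟨ cong (edgeFibre zero *_) (*-comm (suc k) 2) ⟩
    edgeFibre zero * (2 * suc k)       ∎)
  where
  open FibreCount simple cov
  open ≡-Reasoning
  step : ∀ i → fibre (suc i) ≡ fibre (inject₁ i)
  step i = trans (fibre-normal (suc (suc i)) (suc i) refl (inj₂ refl))
                 (sym (fibre-normal (suc (suc i)) (inject₁ i) refl (inj₁ refl)))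

-- Incidence and lifts

[≡?]-≥1 : ∀ {k} {a b : Fin k} → a ≡ b → 1 ≤ [ a ≡? b ]
[≡?]-≥1 a≡b = ≤-reflexive (sym (δ-≡ 1 a≡b))

endsAt-normal⁺ : ∀ {k} {a b x : Fin k} → a ≡ x ⊎ b ≡ x → 1 ≤ [ a ≡? x ] + [ b ≡? x ]
endsAt-normal⁺ (inj₁ a≡x) = ≤-trans ([≡?]-≥1 a≡x) (m≤m+n _ _)
endsAt-normal⁺ (inj₂ b≡x) = ≤-trans ([≡?]-≥1 b≡x) (m≤n+m _ _)

endsAt-normal⁻ : ∀ {k} (a b x : Fin k) → 1 ≤ [ a ≡? x ] + [ b ≡? x ] → a ≡ x ⊎ b ≡ x
endsAt-normal⁻ a b x p with a ≟ x | b ≟ x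
... | yes a≡x | _       = inj₁ a≡x
... | no _    | yes b≡x = inj₂ b≡x
... | no _    | no _    = ⊥-elim (1+n≰n p)

endsAt-loop⁺ : ∀ {k} {a x : Fin k} → a ≡ x → 1 ≤ 2 * [ a ≡? x ]
endsAt-loop⁺ a≡x = ≤-trans ([≡?]-≥1 a≡x) (m≤m+n _ _)

endsAt-loop⁻ : ∀ {k} (a x : Fin k) → 1 ≤ 2 * [ a ≡? x ] → a ≡ x
endsAt-loop⁻ a x p with a ≟ x
... | yes a≡x = a≡x
... | no _    = ⊥-elim (1+n≰n p)

endsAt-Incid : ∀ {k l} (f : Fin k → Fin l) s t x → Incid f s t → 1 ≤ endsAt s x → 1 ≤ endsAt t (f x)
endsAt-Incid f (normal a b) t x i p with endsAt-normal⁻ a b x p | t | i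
... | inj₁ refl | normal u v | inj₁ (fa≡u , _) = endsAt-normal⁺ (inj₁ (sym fa≡u))
... | inj₁ refl | normal u v | inj₂ (fa≡v , _) = endsAt-normal⁺ (inj₂ (sym fa≡v))
... | inj₂ refl | normal u v | inj₁ (_ , fb≡v) = endsAt-normal⁺ (inj₂ (sym fb≡v))
... | inj₂ refl | normal u v | inj₂ (_ , fb≡u) = endsAt-normal⁺ (inj₁ (sym fb≡u))
... | inj₁ refl | loop u     | fa≡u , _        = endsAt-loop⁺ (sym fa≡u)
... | inj₂ refl | loop u     | _ , fb≡u        = endsAt-loop⁺ (sym fb≡u)
... | inj₁ refl | semi u     | fa≡u , _        = [≡?]-≥1 (sym fa≡u)
... | inj₂ refl | semi u     | _ , fb≡u        = [≡?]-≥1 (sym fb≡u)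
endsAt-Incid f (loop a) (loop u) x fa≡u p with endsAt-loop⁻ a x p
... | refl = endsAt-loop⁺ (sym fa≡u)
endsAt-Incid f (semi a) (semi u) x fa≡u p with [≡?]-positive a x p
... | refl = [≡?]-≥1 (sym fa≡u)

-- H loopless: both counts below are 0 or 1, so inclusion of supports forces equality.
LocalBij-lift : ∀ {G H K} (π : Covering G H) (κ : Covering K H) → (∀ h v → endsAt (edge H h) v ≤ 1) →
  (gV : Fin (nV G) → Fin (nV K)) (gE : Fin (nE G) → Fin (nE K)) →
  (∀ x → Covering.fV κ (gV x) ≡ Covering.fV π x) → (∀ e → Covering.fE κ (gE e) ≡ Covering.fE π e) →
  (∀ e → Incid gV (edge G e) (edge K (gE e))) → LocalBij G K gV gE
LocalBij-lift {G} {H} {K} π κ loopless gV gE κgV≡πV κgE≡πE incid x j =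
  trans (sym (δ-self h _)) (trans (sum≤1-match A B ΣA≡ΣB ΣB≤1 supp j) (δ-self h _))
  where
  module π = Covering π
  module κ = Covering κ
  h = κ.fE j
  edgesAt : Fin (nE K) → ℕ
  edgesAt j′ = ∑[ e < nE G ] δ (gE e) j′ (endsAt (edge G e) x)
  A B : Fin (nE K) → ℕ
  A j′ = δ (κ.fE j′) h (edgesAt j′)
  B j′ = δ (κ.fE j′) h (endsAt (edge K j′) (gV x))
  ΣA : sum A ≡ endsAt (edge H h) (π.fV x)
  ΣA = begin
      ∑[ j′ < nE K ] δ (κ.fE j′) h (edgesAt j′)
    ≡⟨ sum-partition-∘ gE κ.fE (λ e → endsAt (edge G e) x) h ⟨
      ∑[ e < nE G ] δ (κ.fE (gE e)) h (endsAt (edge G e) x)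
    ≡⟨ sum-cong-≗ {nE G} (λ e → cong (λ h′ → δ h′ h (endsAt (edge G e) x)) (κgE≡πE e)) ⟩
      ∑[ e < nE G ] δ (π.fE e) h (endsAt (edge G e) x)
    ≡⟨ localBij π x h ⟩
      endsAt (edge H h) (π.fV x)
    ∎
    where open ≡-Reasoning
  ΣB : sum B ≡ endsAt (edge H h) (π.fV x)
  ΣB = trans (localBij κ (gV x) h) (cong (endsAt (edge H h)) (κgV≡πV x))
  ΣA≡ΣB : sum A ≡ sum B
  ΣA≡ΣB = trans ΣA (sym ΣB)
  ΣB≤1 : sum B ≤ 1
  ΣB≤1 = subst (_≤ 1) (sym ΣB) (loopless h _)
  supp : ∀ j′ → 1 ≤ A j′ → 1 ≤ B j′
  supp j′ p with δ-positive (κ.fE j′) h (edgesAt j′) p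
  ... | κj′≡h , q with sum-positive _ q
  ... | e , r with δ-positive (gE e) j′ (endsAt (edge G e) x) r
  ... | refl , s = subst (1 ≤_) (sym (δ-≡ _ κj′≡h)) (endsAt-Incid gV (edge G e) (edge K (gE e)) x (incid e) s)

-- Cycles

suc-%-% : ∀ t M .{{_ : NonZero M}} → suc (t % M) % M ≡ suc t % M
suc-%-% t M = begin
  suc (t % M) % M              ≡⟨ %-distribˡ-+ 1 (t % M) M ⟩
  (1 % M + t % M % M) % M      ≡⟨ cong (λ z → (1 % M + z) % M) (m%n%n≡m%n t M) ⟩
  (1 % M + t % M) % M          ≡⟨ %-distribˡ-+ 1 t M ⟨
  suc t % M                    ∎
  where open ≡-Reasoning

module Cycle (k : ℕ) where
  N : ℕ
  N = suc (suc k)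

  prev : Fin N → Fin N
  prev zero    = fromℕ (suc k)
  prev (suc i) = inject₁ i

  next : Fin N → Fin N
  next x = fromℕ< (m%n<n (suc (toℕ x)) N)

  toℕ-next : ∀ x → toℕ (next x) ≡ suc (toℕ x) % N
  toℕ-next x = toℕ-fromℕ< (m%n<n (suc (toℕ x)) N)

  next-prev : ∀ e → next (prev e) ≡ e
  next-prev zero = toℕ-injective (begin
    toℕ (next (fromℕ (suc k)))   ≡⟨ toℕ-next (fromℕ (suc k)) ⟩
    suc (toℕ (fromℕ (suc k))) % N ≡⟨ cong (λ z → suc z % N) (toℕ-fromℕ (suc k)) ⟩
    N % N                        ≡⟨ n%n≡0 N ⟩
    0                            ∎)
    where open ≡-Reasoning
  next-prev (suc i) = toℕ-injective (begin
    toℕ (next (inject₁ i))       ≡⟨ toℕ-next (inject₁ i) ⟩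
    suc (toℕ (inject₁ i)) % N    ≡⟨ cong (λ z → suc z % N) (toℕ-inject₁ i) ⟩
    suc (toℕ i) % N              ≡⟨ m<n⇒m%n≡m (s≤s (toℕ<n i)) ⟩
    suc (toℕ i)                  ∎)
    where open ≡-Reasoning

  prev-next : ∀ x → prev (next x) ≡ x
  prev-next x with m≤n⇒m<n∨m≡n (toℕ<n x)
  ... | inj₁ x<last = toℕ-injective (prev-of-suc (next x) (trans (toℕ-next x) (m<n⇒m%n≡m x<last)))
    where
    prev-of-suc : ∀ y → toℕ y ≡ suc (toℕ x) → toℕ (prev y) ≡ toℕ x
    prev-of-suc (suc i) eq = trans (toℕ-inject₁ i) (suc-injective eq)
  ... | inj₂ x≡last =
    toℕ-injective (prev-of-zero (next x) (trans (toℕ-next x) (trans (cong (_% N) x≡last) (n%n≡0 N))))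
    where
    prev-of-zero : ∀ y → toℕ y ≡ 0 → toℕ (prev y) ≡ toℕ x
    prev-of-zero zero _ = trans (toℕ-fromℕ (suc k)) (suc-injective (sym x≡last))

  endsAt-cycEdge : ∀ e x → endsAt (cycEdge k e) x ≡ [ e ≡? next x ] + [ e ≡? x ]
  endsAt-cycEdge e x = trans (ends e) (cong (_+ [ e ≡? x ]) prev-e≡x)
    where
    prev-e≡x : [ prev e ≡? x ] ≡ [ e ≡? next x ]
    prev-e≡x = δ-iff (prev e) x e (next x) 1 (λ p → trans (sym (next-prev e)) (cong next p))
                                                 (λ p → trans (cong prev p) (prev-next x))
    ends : ∀ e → endsAt (cycEdge k e) x ≡ [ prev e ≡? x ] + [ e ≡? x ]
    ends zero    = +-comm [ zero ≡? x ] [ fromℕ (suc k) ≡? x ]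
    ends (suc i) = refl

  ∑δ-endsAt-cycEdge : ∀ {l} (fE : Fin N → Fin l) x h →
    ∑[ e < N ] δ (fE e) h (endsAt (cycEdge k e) x) ≡ [ fE (next x) ≡? h ] + [ fE x ≡? h ]
  ∑δ-endsAt-cycEdge fE x h = begin
      ∑[ e < N ] δ (fE e) h (endsAt (cycEdge k e) x)
    ≡⟨ sum-cong-≗ {N} (λ e → trans (cong (δ (fE e) h) (endsAt-cycEdge e x))
                                    (δ-distrib-+ (fE e) h [ e ≡? next x ] [ e ≡? x ])) ⟩
      ∑[ e < N ] (δ (fE e) h [ e ≡? next x ] + δ (fE e) h [ e ≡? x ])
    ≡⟨ ∑-distrib-+ (λ e → δ (fE e) h [ e ≡? next x ]) (λ e → δ (fE e) h [ e ≡? x ]) ⟩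
      ∑[ e < N ] δ (fE e) h [ e ≡? next x ] + ∑[ e < N ] δ (fE e) h [ e ≡? x ]
    ≡⟨ cong₂ _+_ (pick (next x)) (pick x) ⟩
      [ fE (next x) ≡? h ] + [ fE x ≡? h ]
    ∎
    where
    open ≡-Reasoning
    pick : ∀ y → ∑[ e < N ] δ (fE e) h [ e ≡? y ] ≡ [ fE y ≡? h ]
    pick y = trans (sum-cong-≗ {N} (λ e → δ-comm (fE e) h e y 1)) (sum-δ y (λ e → [ fE e ≡? h ]))

  deg-C : ∀ x → deg (C N) x ≡ 2
  deg-C x = begin
      deg (C N) x
    ≡⟨ deg≡sum (C N) x ⟩
      ∑[ e < N ] endsAt (cycEdge k e) x
    ≡⟨ sum-cong-≗ {N} (λ e → endsAt-cycEdge e x) ⟩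
      ∑[ e < N ] ([ e ≡? next x ] + [ e ≡? x ])
    ≡⟨ ∑-distrib-+ (λ e → [ e ≡? next x ]) (λ e → [ e ≡? x ]) ⟩
      ∑[ e < N ] [ e ≡? next x ] + ∑[ e < N ] [ e ≡? x ]
    ≡⟨ cong₂ _+_ (sum-δ (next x) (λ _ → 1)) (sum-δ x (λ _ → 1)) ⟩
      2
    ∎
    where open ≡-Reasoning

  Incid-cycEdge : ∀ {l} (f : Fin N → Fin l) e t → Incid f (normal (prev e) e) t → Incid f (cycEdge k e) t
  Incid-cycEdge f zero    (normal u v) i       = SameEnds-swapˡ i
  Incid-cycEdge f zero    (loop u)     (p , q) = q , p
  Incid-cycEdge f zero    (semi u)     (p , q) = q , p
  Incid-cycEdge f (suc i) t            p       = p

  Incid-into-cycEdge : ∀ {l} (f : Fin l → Fin N) a b j →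
    SameEnds (f a) (f b) (prev j) j → Incid f (normal a b) (cycEdge k j)
  Incid-into-cycEdge f a b zero    s = SameEnds-swapʳ s
  Incid-into-cycEdge f a b (suc i) s = s

  Incid-into-cycEdge⁻ : ∀ {l} (f : Fin l → Fin N) a b j →
    Incid f (normal a b) (cycEdge k j) → SameEnds (f a) (f b) (prev j) j
  Incid-into-cycEdge⁻ f a b zero    s = SameEnds-swapʳ s
  Incid-into-cycEdge⁻ f a b (suc i) s = s

  next-induction : ∀ (P : Fin N → Set) t₀ → P t₀ → (∀ t → P t → P (next t)) → ∀ t → P t
  next-induction P t₀ base step t = subst P reaches-t (go i)
    where
    iterate : ℕ → Fin N
    iterate zero    = t₀
    iterate (suc j) = next (iterate j)
    go : ∀ j → P (iterate j)
    go zero    = base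
    go (suc j) = step (iterate j) (go j)
    toℕ-iterate : ∀ j → toℕ (iterate j) ≡ (toℕ t₀ + j) % N
    toℕ-iterate zero    = sym (trans (cong (_% N) (+-identityʳ (toℕ t₀))) (m<n⇒m%n≡m (toℕ<n t₀)))
    toℕ-iterate (suc j) = begin
      toℕ (next (iterate j))     ≡⟨ toℕ-next (iterate j) ⟩
      suc (toℕ (iterate j)) % N  ≡⟨ cong (λ z → suc z % N) (toℕ-iterate j) ⟩
      suc ((toℕ t₀ + j) % N) % N ≡⟨ suc-%-% (toℕ t₀ + j) N ⟩
      suc (toℕ t₀ + j) % N       ≡⟨ cong (_% N) (+-suc (toℕ t₀) j) ⟨
      (toℕ t₀ + suc j) % N       ∎
      where open ≡-Reasoning
    i : ℕ
    i = (toℕ t + N) ∸ toℕ t₀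
    reaches-t : iterate i ≡ t
    reaches-t = toℕ-injective (begin
      toℕ (iterate i)        ≡⟨ toℕ-iterate i ⟩
      (toℕ t₀ + i) % N       ≡⟨ cong (_% N) (m+[n∸m]≡n (<⇒≤ (<-≤-trans (toℕ<n t₀) (m≤n+m N (toℕ t))))) ⟩
      (toℕ t + N) % N        ≡⟨ [m+n]%n≡m%n (toℕ t) N ⟩
      toℕ t % N              ≡⟨ m<n⇒m%n≡m (toℕ<n t) ⟩
      toℕ t                  ∎)
      where open ≡-Reasoning

C-deg : ∀ N .{{_ : NonZero N}} x → deg (C N) x ≡ 2
C-deg 1             zero = refl
C-deg (suc (suc k)) x    = Cycle.deg-C k x

C-no-semi : ∀ N .{{_ : NonZero N}} e x → edge (C N) e ≢ semi x
C-no-semi 1             _       _ ()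
C-no-semi (suc (suc k)) zero    _ ()
C-no-semi (suc (suc k)) (suc i) _ ()

covers-C1 : ∀ G → Fin (nV G) → Fin (nE G) → (∀ e x → edge G e ≢ semi x) →
            (∀ x → deg G x ≡ 2) → Covering G (C 1)
covers-C1 G x₀ e₀ no-semi deg≡2 =
  covering (λ _ → zero) (λ _ → zero) (λ { zero → x₀ , refl }) (λ { zero → e₀ , refl })
    (λ e → incid (edge G e) (no-semi e)) lb
  where
  incid : ∀ s → (∀ x → s ≢ semi x) → Incid (λ _ → zero) s (loop zero)
  incid (normal a b) _       = refl , refl
  incid (loop a)     _       = refl
  incid (semi a)     no-semi = ⊥-elim (no-semi a refl)
  lb : LocalBij G (C 1) (λ _ → zero) (λ _ → zero)
  lb x zero = trans (sum-cong-≗ {nE G} (λ e → δ-self {1} zero (endsAt (edge G e) x)))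
                    (trans (sym (deg≡sum G x)) (deg≡2 x))

module Wrap (k k′ : ℕ) (M∣N : suc (suc k′) ∣ suc (suc k)) where
  open Cycle k
  module T = Cycle k′
  M : ℕ
  M = suc (suc k′)

  wrap : Fin N → Fin M
  wrap x = fromℕ< (m%n<n (toℕ x) M)

  toℕ-wrap : ∀ x → toℕ (wrap x) ≡ toℕ x % M
  toℕ-wrap x = toℕ-fromℕ< (m%n<n (toℕ x) M)

  wrap-next : ∀ x → wrap (next x) ≡ T.next (wrap x)
  wrap-next x = toℕ-injective (begin
      toℕ (wrap (next x))         ≡⟨ toℕ-wrap (next x) ⟩
      toℕ (next x) % M            ≡⟨ cong (_% M) (toℕ-next x) ⟩
      suc (toℕ x) % N % M         ≡⟨ m∣n⇒o%n%m≡o%m M N (suc (toℕ x)) M∣N ⟩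
      suc (toℕ x) % M             ≡⟨ suc-%-% (toℕ x) M ⟨
      suc (toℕ x % M) % M         ≡⟨ cong (λ z → suc z % M) (toℕ-wrap x) ⟨
      suc (toℕ (wrap x)) % M      ≡⟨ T.toℕ-next (wrap x) ⟨
      toℕ (T.next (wrap x))       ∎)
    where open ≡-Reasoning

  wrap-prev : ∀ e → wrap (prev e) ≡ T.prev (wrap e)
  wrap-prev e = begin
      wrap (prev e)                 ≡⟨ T.prev-next (wrap (prev e)) ⟨
      T.prev (T.next (wrap (prev e))) ≡⟨ cong T.prev (wrap-next (prev e)) ⟨
      T.prev (wrap (next (prev e))) ≡⟨ cong (T.prev ∘ wrap) (next-prev e) ⟩
      T.prev (wrap e)               ∎
    where open ≡-Reasoning

  wrap-surjective : ∀ u → ∃ λ x → wrap x ≡ u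
  wrap-surjective u = fromℕ< u<N , toℕ-injective (begin
      toℕ (wrap (fromℕ< u<N))   ≡⟨ toℕ-wrap (fromℕ< u<N) ⟩
      toℕ (fromℕ< u<N) % M      ≡⟨ cong (_% M) (toℕ-fromℕ< u<N) ⟩
      toℕ u % M                 ≡⟨ m<n⇒m%n≡m (toℕ<n u) ⟩
      toℕ u                     ∎)
    where
    open ≡-Reasoning
    u<N : toℕ u < N
    u<N = <-≤-trans (toℕ<n u) (∣⇒≤ M∣N)

  covering-wrap : Covering (C N) (C M)
  covering-wrap = covering wrap wrap wrap-surjective wrap-surjective incid lb
    where
    incid : ∀ e → Incid wrap (cycEdge k e) (cycEdge k′ (wrap e))
    incid e = Incid-cycEdge wrap e _ (T.Incid-into-cycEdge wrap (prev e) e (wrap e) (inj₁ (wrap-prev e , refl)))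
    lb : LocalBij (C N) (C M) wrap wrap
    lb x h = begin
        ∑[ e < N ] δ (wrap e) h (endsAt (cycEdge k e) x)
      ≡⟨ ∑δ-endsAt-cycEdge wrap x h ⟩
        [ wrap (next x) ≡? h ] + [ wrap x ≡? h ]
      ≡⟨ cong (λ z → [ z ≡? h ] + [ wrap x ≡? h ]) (wrap-next x) ⟩
        [ T.next (wrap x) ≡? h ] + [ wrap x ≡? h ]
      ≡⟨ cong₂ _+_ (δ-sym (T.next (wrap x)) h 1) (δ-sym (wrap x) h 1) ⟩
        [ h ≡? T.next (wrap x) ] + [ h ≡? wrap x ]
      ≡⟨ T.endsAt-cycEdge h (wrap x) ⟨
        endsAt (cycEdge k′ h) (wrap x)
      ∎
      where open ≡-Reasoning

C-covers-C : ∀ N m .{{_ : NonZero N}} .{{_ : NonZero m}} → m ∣ N → Covering (C N) (C m)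
C-covers-C 1             1              _   = covers-C1 (C 1) zero zero (C-no-semi 1) (C-deg 1)
C-covers-C (suc (suc k)) 1              _   = covers-C1 (C (suc (suc k))) zero zero
                                                (C-no-semi (suc (suc k))) (C-deg (suc (suc k)))
C-covers-C 1             (suc (suc k′)) m∣1 with ∣⇒≤ m∣1
... | s≤s ()
C-covers-C (suc (suc k)) (suc (suc k′)) m∣N = Wrap.covering-wrap k k′ m∣N

C-simple : ∀ N .{{_ : NonZero N}} → 3 ≤ N → Simple (C N)
C-simple (suc (suc (suc k))) _ = record { all-normal = all-normal ; no-parallel = no-parallel }
  where
  open Cycle (suc k)
  all-normal : ∀ e → ∃₂ λ a b → cycEdge (suc k) e ≡ normal a b
  all-normal zero    = zero , fromℕ (suc (suc k)) , refl
  all-normal (suc i) = inject₁ i , suc i , refl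
  ends : ∀ e {x y} → cycEdge (suc k) e ≡ normal x y → SameEnds x y (prev e) e
  ends zero    refl = inj₂ (refl , refl)
  ends (suc i) refl = inj₁ (refl , refl)
  prev-prev≢ : ∀ e → prev (prev e) ≢ e
  prev-prev≢ (suc (suc j)) eq = n≢2+n (toℕ j) (begin
      toℕ j                           ≡⟨ toℕ-inject₁ j ⟨
      toℕ (inject₁ j)                 ≡⟨ toℕ-inject₁ (inject₁ j) ⟨
      toℕ (inject₁ (inject₁ j))       ≡⟨ cong toℕ eq ⟩
      suc (suc (toℕ j))               ∎)
    where
    open ≡-Reasoning
    n≢2+n : ∀ n → n ≢ suc (suc n)
    n≢2+n n eq = <-irrefl eq (≤-trans (n<1+n n) (n≤1+n (suc n)))
  no-parallel : ∀ e e′ x y x′ y′ →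
                cycEdge (suc k) e ≡ normal x y → cycEdge (suc k) e′ ≡ normal x′ y′ →
                SameEnds x y x′ y′ → e ≡ e′
  no-parallel e e′ x y x′ y′ p q s
    with SameEnds-trans (SameEnds-trans (SameEnds-sym (ends e p)) s) (ends e′ q)
  ... | inj₁ (_ , e≡e′)            = e≡e′
  ... | inj₂ (prev-e≡e′ , e≡prev-e′) = ⊥-elim (prev-prev≢ e (trans (cong prev prev-e≡e′) (sym e≡prev-e′)))
C-simple 1             (s≤s ())
C-simple (suc (suc zero)) (s≤s (s≤s ()))

-- The cycle is connected: the image of gV contains, with each vertex, its successor.
module _ (k : ℕ) {G : Graph} (simple : Simple G) (x₀ : Fin (nV G))
         (gV : Fin (nV G) → Fin (suc (suc k))) (gE : Fin (nE G) → Fin (suc (suc k)))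
         (incid : ∀ e → Incid gV (edge G e) (cycEdge k (gE e))) (lb : LocalBij G (C (suc (suc k))) gV gE)
         where
  open Cycle k

  private
    edge-over : ∀ x j → 1 ≤ [ j ≡? next (gV x) ] + [ j ≡? gV x ] →
                ∃ λ e → gE e ≡ j × 1 ≤ endsAt (edge G e) x
    edge-over x j p =
      LocalBij-lift-edge {G} {C (suc (suc k))} lb x j (subst (1 ≤_) (sym (endsAt-cycEdge j (gV x))) p)

    step : ∀ t → (∃ λ x → gV x ≡ t) → ∃ λ y → gV y ≡ next t
    step t (x , refl) with edge-over x (next t) (≤-trans ([≡?]-≥1 {a = next t} refl) (m≤m+n _ _))
    ... | e , gEe≡ , _ with Simple.all-normal simple e
    ...   | a , b , eq with Incid-into-cycEdge⁻ gV a b (gE e) (subst (λ s → Incid gV s _) eq (incid e))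
    ...     | inj₁ (_ , gVb≡) = b , trans gVb≡ gEe≡
    ...     | inj₂ (gVa≡ , _) = a , trans gVa≡ gEe≡

  localBij⇒covering-C : Covering G (C (suc (suc k)))
  localBij⇒covering-C = covering gV gE gV-surjective gE-surjective incid lb
    where
    gV-surjective : ∀ t → ∃ λ x → gV x ≡ t
    gV-surjective = next-induction _ (gV x₀) (x₀ , refl) step
    gE-surjective : ∀ j → ∃ λ e → gE e ≡ j
    gE-surjective j with gV-surjective j
    ... | x , refl with edge-over x j (≤-trans ([≡?]-≥1 {a = j} refl) (m≤n+m _ _))
    ...   | e , gEe≡ , _ = e , gEe≡

-- Paths, and the folding of C 2m onto P̃ m

[_≡ᴺ?_] : ℕ → ℕ → ℕ
[ a ≡ᴺ? b ] = if ⌊ a ≟ℕ b ⌋ then 1 else 0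

[≡?]-toℕ : ∀ {n} (a b : Fin n) → [ a ≡? b ] ≡ [ toℕ a ≡ᴺ? toℕ b ]
[≡?]-toℕ a b = if-cong (a ≟ b) (toℕ a ≟ℕ toℕ b) 1 (cong toℕ) toℕ-injective

[≡ᴺ?]-sym : ∀ a b → [ a ≡ᴺ? b ] ≡ [ b ≡ᴺ? a ]
[≡ᴺ?]-sym a b = if-cong (a ≟ℕ b) (b ≟ℕ a) 1 sym sym

[≡ᴺ?]-≢ : ∀ {a b} → a ≢ b → [ a ≡ᴺ? b ] ≡ 0
[≡ᴺ?]-≢ {a} {b} a≢b with a ≟ℕ b
... | yes a≡b = ⊥-elim (a≢b a≡b)
... | no _    = refl

SameEndsᴺ : ℕ → ℕ → ℕ → ℕ → Set
SameEndsᴺ a b c d = (a ≡ c × b ≡ d) ⊎ (a ≡ d × b ≡ c)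

SameEndsᴺ-[≡ᴺ?] : ∀ {a b c d} → SameEndsᴺ a b c d → ∀ q →
                  [ a ≡ᴺ? q ] + [ b ≡ᴺ? q ] ≡ [ c ≡ᴺ? q ] + [ d ≡ᴺ? q ]
SameEndsᴺ-[≡ᴺ?] (inj₁ (refl , refl)) q = refl
SameEndsᴺ-[≡ᴺ?] {a} {b} (inj₂ (refl , refl)) q = +-comm [ a ≡ᴺ? q ] [ b ≡ᴺ? q ]

SameEndsᴺ-toℕ : ∀ {l} {w x y z : Fin l} → SameEndsᴺ (toℕ w) (toℕ x) (toℕ y) (toℕ z) → SameEnds w x y z
SameEndsᴺ-toℕ (inj₁ (p , q)) = inj₁ (toℕ-injective p , toℕ-injective q)
SameEndsᴺ-toℕ (inj₂ (p , q)) = inj₂ (toℕ-injective p , toℕ-injective q)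

SameEndsᴺ-cong : ∀ {a b c d a′ b′ c′ d′} → a ≡ a′ → b ≡ b′ → c ≡ c′ → d ≡ d′ →
                 SameEndsᴺ a b c d → SameEndsᴺ a′ b′ c′ d′
SameEndsᴺ-cong refl refl refl refl s = s

module Path (k : ℕ) where
  -- The path edge at position p joins p − 1 and p; positions 0 and suc k are the semi-edges.
  position : Fin (suc (suc k)) → ℕ
  position zero          = 0
  position (suc zero)    = suc k
  position (suc (suc i)) = suc (toℕ i)

  position≤ : ∀ h → position h ≤ suc k
  position≤ zero          = z≤n
  position≤ (suc zero)    = ≤-refl
  position≤ (suc (suc i)) = s≤s (<⇒≤ (toℕ<n i))

  position-injective : ∀ h h′ → position h ≡ position h′ → h ≡ h′
  position-injective zero          zero           _ = refl
  position-injective (suc zero)    (suc zero)     _ = refl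
  position-injective (suc (suc i)) (suc (suc j))  p =
    cong (λ (j : Fin k) → suc (suc j)) (toℕ-injective (suc-injective p))
  position-injective (suc zero)    (suc (suc j))  p = ⊥-elim (<-irrefl (sym (suc-injective p)) (toℕ<n j))
  position-injective (suc (suc i)) (suc zero)     p = ⊥-elim (<-irrefl (suc-injective p) (toℕ<n i))
  position-injective zero          (suc zero)     ()
  position-injective zero          (suc (suc _))  ()
  position-injective (suc zero)    zero           ()
  position-injective (suc (suc _)) zero           ()

  edgeAt : ∀ p → p ≤ suc k → Fin (suc (suc k))
  edgeAt zero    _ = zero
  edgeAt (suc p) p<m with p ≟ℕ k
  ... | yes _   = suc zero
  ... | no  p≢k = suc (suc (fromℕ< (≤∧≢⇒< (s≤s⁻¹ p<m) p≢k)))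

  position-edgeAt : ∀ p p≤m → position (edgeAt p p≤m) ≡ p
  position-edgeAt zero    _ = refl
  position-edgeAt (suc p) _ with p ≟ℕ k
  ... | yes p≡k = cong suc (sym p≡k)
  ... | no  _   = cong suc (toℕ-fromℕ< _)

  [edgeAt≡?] : ∀ p p≤m h → [ edgeAt p p≤m ≡? h ] ≡ [ p ≡ᴺ? position h ]
  [edgeAt≡?] p p≤m h = if-cong (edgeAt p p≤m ≟ h) (p ≟ℕ position h) 1
    (λ eq → trans (sym (position-edgeAt p p≤m)) (cong position eq))
    (λ eq → position-injective _ _ (trans (position-edgeAt p p≤m) eq))

  endsAt-pathEdge : ∀ h v →
    endsAt (pathEdge k h) v ≡ [ position h ≡ᴺ? toℕ v ] + [ position h ≡ᴺ? suc (toℕ v) ]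
  endsAt-pathEdge zero v = trans ([≡?]-toℕ zero v) (sym (+-identityʳ _))
  endsAt-pathEdge (suc zero) v = trans last≡ (cong (_+ [ suc k ≡ᴺ? suc (toℕ v) ]) (sym ([≡ᴺ?]-≢ m≢v)))
    where
    last≡ : [ fromℕ k ≡? v ] ≡ [ suc k ≡ᴺ? suc (toℕ v) ]
    last≡ = if-cong (fromℕ k ≟ v) (suc k ≟ℕ suc (toℕ v)) 1
      (λ { refl → cong suc (sym (toℕ-fromℕ k)) })
      (λ eq → toℕ-injective (trans (toℕ-fromℕ k) (suc-injective eq)))
    m≢v : suc k ≢ toℕ v
    m≢v eq = 1+n≰n (subst (_≤ k) (sym eq) (s≤s⁻¹ (toℕ<n v)))
  endsAt-pathEdge (suc (suc i)) v =
    trans (+-comm [ inject₁ i ≡? v ] _) (cong₂ _+_ ([≡?]-toℕ (suc i) v) inner≡)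
    where
    inner≡ : [ inject₁ i ≡? v ] ≡ [ suc (toℕ i) ≡ᴺ? suc (toℕ v) ]
    inner≡ = if-cong (inject₁ i ≟ v) (suc (toℕ i) ≟ℕ suc (toℕ v)) 1
      (λ eq → cong suc (trans (sym (toℕ-inject₁ i)) (cong toℕ eq)))
      (λ eq → toℕ-injective (trans (toℕ-inject₁ i) (suc-injective eq)))

  Incid-into-pathEdge : ∀ {l} (f : Fin l → Fin (suc k)) a b h →
    SameEndsᴺ (toℕ (f a)) (toℕ (f b)) (pred (position h)) (position h ⊓ k) →
    Incid f (normal a b) (pathEdge k h)
  Incid-into-pathEdge f a b zero (inj₁ (p , q)) = toℕ-injective p , toℕ-injective q
  Incid-into-pathEdge f a b zero (inj₂ (p , q)) = toℕ-injective p , toℕ-injective q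
  Incid-into-pathEdge f a b (suc zero) s
    with SameEndsᴺ-cong refl refl (sym (toℕ-fromℕ k)) (trans m⊓k≡k (sym (toℕ-fromℕ k))) s
    where
    m⊓k≡k : suc k ⊓ k ≡ k
    m⊓k≡k = m≥n⇒m⊓n≡n (n≤1+n k)
  ... | inj₁ (p , q) = toℕ-injective p , toℕ-injective q
  ... | inj₂ (p , q) = toℕ-injective p , toℕ-injective q
  Incid-into-pathEdge f a b (suc (suc i)) s =
    SameEndsᴺ-toℕ (SameEndsᴺ-cong refl refl (sym (toℕ-inject₁ i)) (m≤n⇒m⊓n≡m (toℕ<n i)) s)

-- Vertex t of C 2m folds to t in the lower half and to 2m − 1 − t in the upper half; the cycle
-- edge j, joining j − 1 and j, folds to the path edge at position min (j, 2m − j).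
module FoldArithmetic (k : ℕ) where
  m N : ℕ
  m = suc k
  N = suc (suc (k + k))

  N≡m+m : N ≡ m + m
  N≡m+m = cong suc (sym (+-suc k k))

  m<N : m < N
  m<N = s≤s (s≤s (m≤m+n k k))

  N∸m≡m : N ∸ m ≡ m
  N∸m≡m = m+n∸n≡m (suc k) k

  fold : ℕ → ℕ
  fold t with t <? m
  ... | yes _ = t
  ... | no _  = N ∸ suc t

  foldEdge : ℕ → ℕ
  foldEdge j = j ⊓ (N ∸ j)

  fold-lower : ∀ {t} → t < m → fold t ≡ t
  fold-lower {t} t<m with t <? m
  ... | yes _   = refl
  ... | no  t≮m = ⊥-elim (t≮m t<m)

  fold-upper : ∀ s → fold (m + s) ≡ k ∸ s
  fold-upper s with m + s <? m
  ... | yes m+s<m = ⊥-elim (m+n≮m m s m+s<m)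
  ... | no  _     = [m+n]∸[m+o]≡n∸o k k s

  fold-m : fold m ≡ k
  fold-m = trans (cong fold (sym (+-identityʳ m))) (fold-upper 0)

  foldEdge-lower : ∀ {j} → j ≤ m → foldEdge j ≡ j
  foldEdge-lower {j} j≤m = m≤n⇒m⊓n≡m (≤-trans j≤m (≤-trans (≤-reflexive (sym N∸m≡m)) (∸-monoʳ-≤ N j≤m)))

  foldEdge-upper : ∀ s → foldEdge (m + s) ≡ m ∸ s
  foldEdge-upper s = trans (cong ((m + s) ⊓_) N∸[m+s]) (m≥n⇒m⊓n≡n (≤-trans (m∸n≤m m s) (m≤m+n m s)))
    where
    N∸[m+s] : N ∸ (m + s) ≡ m ∸ s
    N∸[m+s] = trans (cong (_∸ (k + s)) (sym (+-suc k k))) ([m+n]∸[m+o]≡n∸o k (suc k) s)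

  foldEdge≤m : ∀ j → foldEdge j ≤ m
  foldEdge≤m j with ≤-total j m
  ... | inj₁ j≤m = ≤-trans (m⊓n≤m j (N ∸ j)) j≤m
  ... | inj₂ m≤j = ≤-trans (m⊓n≤n j (N ∸ j)) (≤-trans (∸-monoʳ-≤ N m≤j) (≤-reflexive N∸m≡m))

  data Half : ℕ → Set where
    lower : ∀ {t} → t < m → Half t
    upper : ∀ {s} → s < m → Half (m + s)

  half : ∀ t → t < N → Half t
  half t t<N with t <? m
  ... | yes t<m = lower t<m
  ... | no  t≮m = subst Half (m+[n∸m]≡n m≤t) (upper (+-cancelˡ-< m (t ∸ m) m m+[t∸m]<m+m))
    where
    m≤t : m ≤ t
    m≤t = ≮⇒≥ t≮m
    m+[t∸m]<m+m : m + (t ∸ m) < m + m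
    m+[t∸m]<m+m = subst₂ _<_ (sym (m+[n∸m]≡n m≤t)) N≡m+m t<N

  fold<m : ∀ t → t < N → fold t < m
  fold<m t t<N with half t t<N
  ... | lower t<m = subst (_< m) (sym (fold-lower t<m)) t<m
  ... | upper {s} _ = subst (_< m) (sym (fold-upper s)) (s≤s (m∸n≤m k s))

  data Step : ℕ → Set where
    inner-lower : ∀ {t} → suc t < m → Step t
    middle      : Step k
    inner-upper : ∀ {s} → suc s < m → Step (m + s)
    last        : Step (m + k)

  step-view : ∀ t → t < N → Step t
  step-view t t<N with half t t<N
  ... | lower t<m with m≤n⇒m<n∨m≡n t<m
  ...   | inj₁ 1+t<m = inner-lower 1+t<m
  ...   | inj₂ refl  = middle
  step-view _ _ | upper s<m with m≤n⇒m<n∨m≡n s<m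
  ...   | inj₁ 1+s<m = inner-upper 1+s<m
  ...   | inj₂ refl  = last

  next-lower : ∀ {t} → t < m → suc t % N ≡ suc t
  next-lower t<m = m<n⇒m%n≡m (≤-trans (s≤s t<m) m<N)

  next-upper : ∀ {s} → suc s < m → suc (m + s) % N ≡ m + suc s
  next-upper {s} 1+s<m = trans (cong (_% N) (sym (+-suc m s)))
    (m<n⇒m%n≡m (subst (m + suc s <_) (sym N≡m+m) (+-monoʳ-< m 1+s<m)))

  next-last : suc (m + k) % N ≡ 0
  next-last = n%n≡0 N

  edges-around : ∀ t → t < N → SameEndsᴺ (foldEdge (suc t % N)) (foldEdge t) (fold t) (suc (fold t))
  edges-around t t<N with step-view t t<N
  ... | inner-lower {t} 1+t<m
    rewrite next-lower (<-trans (n<1+n t) 1+t<m) | foldEdge-lower (<⇒≤ 1+t<m)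
          | foldEdge-lower (<⇒≤ (<-trans (n<1+n t) 1+t<m)) | fold-lower (<-trans (n<1+n t) 1+t<m)
    = inj₂ (refl , refl)
  ... | middle
    rewrite next-lower (n<1+n k) | foldEdge-lower (≤-refl {m}) | foldEdge-lower (n≤1+n k) | fold-lower (n<1+n k)
    = inj₂ (refl , refl)
  ... | inner-upper {s} 1+s<m
    rewrite next-upper 1+s<m | foldEdge-upper (suc s) | foldEdge-upper s | fold-upper s
    = inj₁ (refl , +-∸-assoc 1 (s≤s⁻¹ (<⇒≤ 1+s<m)))
  ... | last
    rewrite next-last | foldEdge-upper k | fold-upper k | n∸n≡0 k
    = inj₁ (refl , m+n∸n≡m 1 k)

  edge-ends : ∀ t → t < N →
    SameEndsᴺ (fold t) (fold (suc t % N)) (pred (foldEdge (suc t % N))) (foldEdge (suc t % N) ⊓ k)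
  edge-ends t t<N with step-view t t<N
  ... | inner-lower {t} 1+t<m
    rewrite next-lower (<-trans (n<1+n t) 1+t<m) | foldEdge-lower (<⇒≤ 1+t<m)
          | fold-lower (<-trans (n<1+n t) 1+t<m) | fold-lower 1+t<m | m≤n⇒m⊓n≡m (s≤s⁻¹ 1+t<m)
    = inj₁ (refl , refl)
  ... | middle
    rewrite next-lower (n<1+n k) | foldEdge-lower (≤-refl {m}) | fold-lower (n<1+n k)
          | fold-m | m≥n⇒m⊓n≡n (n≤1+n k)
    = inj₁ (refl , refl)
  ... | inner-upper {s} 1+s<m
    rewrite next-upper 1+s<m | foldEdge-upper (suc s) | fold-upper s | fold-upper (suc s)
          | m≤n⇒m⊓n≡m (m∸n≤m k s) | pred[m∸n]≡m∸[1+n] k s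
    = inj₂ (refl , refl)
  ... | last
    rewrite next-last | fold-upper k | n∸n≡0 k | fold-lower {0} (s≤s z≤n)
    = inj₁ (refl , refl)

  -- Sections of the folding: sheet true is the lower half of the cycle, false the upper half.
  unfold : ℕ → Bool → ℕ
  unfold v true  = v
  unfold v false = N ∸ suc v

  unfoldEdge : ℕ → Bool → ℕ
  unfoldEdge p true  = p
  unfoldEdge p false = (N ∸ p) % N

  prevᴺ : ℕ → ℕ
  prevᴺ zero    = suc (k + k)
  prevᴺ (suc t) = t

  unfold<N : ∀ {v} b → v < m → unfold v b < N
  unfold<N true  v<m = <-trans v<m m<N
  unfold<N {v} false _ = s≤s (m∸n≤m (suc (k + k)) v)

  unfoldEdge<N : ∀ {p} b → p ≤ m → unfoldEdge p b < N
  unfoldEdge<N true  p≤m = ≤-<-trans p≤m m<N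
  unfoldEdge<N {p} false _ = m%n<n (N ∸ p) N

  fold-unfold : ∀ {v} b → v < m → fold (unfold v b) ≡ v
  fold-unfold true  v<m = fold-lower v<m
  fold-unfold {v} false v<m = begin
      fold (N ∸ suc v)         ≡⟨ cong fold (+-∸-assoc (suc k) v≤k) ⟩
      fold (m + (k ∸ v))       ≡⟨ fold-upper (k ∸ v) ⟩
      k ∸ (k ∸ v)              ≡⟨ m∸[m∸n]≡n v≤k ⟩
      v                        ∎
    where
    open ≡-Reasoning
    v≤k : v ≤ k
    v≤k = s≤s⁻¹ v<m

  N∸[1+q]<N : ∀ q → N ∸ suc q < N
  N∸[1+q]<N q = s≤s (m∸n≤m (suc (k + k)) q)

  foldEdge-unfoldEdge : ∀ {p} b → p ≤ m → foldEdge (unfoldEdge p b) ≡ p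
  foldEdge-unfoldEdge true        p≤m = foldEdge-lower p≤m
  foldEdge-unfoldEdge {zero} false _ = cong foldEdge (n%n≡0 N)
  foldEdge-unfoldEdge {suc q} false 1+q≤m = begin
      foldEdge ((N ∸ suc q) % N)               ≡⟨ cong foldEdge (m<n⇒m%n≡m (N∸[1+q]<N q)) ⟩
      (N ∸ suc q) ⊓ (N ∸ (N ∸ suc q))          ≡⟨ cong ((N ∸ suc q) ⊓_) (m∸[m∸n]≡n 1+q≤N) ⟩
      (N ∸ suc q) ⊓ suc q                      ≡⟨ m≥n⇒m⊓n≡n 1+q≤N∸[1+q] ⟩
      suc q                                    ∎
    where
    open ≡-Reasoning
    1+q≤N : suc q ≤ N
    1+q≤N = <⇒≤ (≤-<-trans 1+q≤m m<N)
    1+q≤N∸[1+q] : suc q ≤ N ∸ suc q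
    1+q≤N∸[1+q] = ≤-trans 1+q≤m (≤-trans (≤-reflexive (sym N∸m≡m)) (∸-monoʳ-≤ N 1+q≤m))

  unfold-semi₀ : ∀ b → SameEndsᴺ (unfold 0 b) (unfold 0 (not b)) (prevᴺ (unfoldEdge 0 b)) (unfoldEdge 0 b)
  unfold-semi₀ true  = inj₂ (refl , refl)
  unfold-semi₀ false = inj₁ (cong prevᴺ (sym (n%n≡0 N)) , sym (n%n≡0 N))

  unfold-semiₘ : ∀ b → SameEndsᴺ (unfold k b) (unfold k (not b)) (prevᴺ (unfoldEdge m b)) (unfoldEdge m b)
  unfold-semiₘ true  = inj₁ (refl , N∸m≡m)
  unfold-semiₘ false = inj₂ (trans N∸m≡m (sym [N∸m]%N≡m) , cong prevᴺ (sym [N∸m]%N≡m))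
    where
    [N∸m]%N≡m : (N ∸ m) % N ≡ m
    [N∸m]%N≡m = trans (cong (_% N) N∸m≡m) (m<n⇒m%n≡m m<N)

  unfold-inner : ∀ {q A B} → q < k → SameEndsᴺ A B q (suc q) → ∀ b →
    SameEndsᴺ (unfold A b) (unfold B b) (prevᴺ (unfoldEdge (suc q) b)) (unfoldEdge (suc q) b)
  unfold-inner q<k ends true = ends
  unfold-inner {q} q<k ends false = SameEndsᴺ-cong refl refl (sym prev≡) (sym mod≡) (reflect ends)
    where
    mod≡ : (N ∸ suc q) % N ≡ N ∸ suc q
    mod≡ = m<n⇒m%n≡m (N∸[1+q]<N q)
    prev≡ : prevᴺ ((N ∸ suc q) % N) ≡ k + k ∸ q
    prev≡ = cong prevᴺ (trans mod≡ (+-∸-assoc 1 (≤-trans (<⇒≤ q<k) (m≤m+n k k))))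
    reflect : ∀ {A B} → SameEndsᴺ A B q (suc q) → SameEndsᴺ (N ∸ suc A) (N ∸ suc B) (k + k ∸ q) (N ∸ suc q)
    reflect (inj₁ (refl , refl)) = inj₂ (refl , refl)
    reflect (inj₂ (refl , refl)) = inj₁ (refl , refl)

module Fold (k : ℕ) where
  open FoldArithmetic k
  open Cycle (k + k) hiding (N)
  open Path k

  foldV : Fin N → Fin m
  foldV x = fromℕ< (fold<m (toℕ x) (toℕ<n x))

  toℕ-foldV : ∀ x → toℕ (foldV x) ≡ fold (toℕ x)
  toℕ-foldV x = toℕ-fromℕ< (fold<m (toℕ x) (toℕ<n x))

  foldE : Fin N → Fin (suc m)
  foldE j = edgeAt (foldEdge (toℕ j)) (foldEdge≤m (toℕ j))

  position-foldE : ∀ j → position (foldE j) ≡ foldEdge (toℕ j)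
  position-foldE j = position-edgeAt (foldEdge (toℕ j)) (foldEdge≤m (toℕ j))

  foldV-surjective : ∀ v → ∃ λ x → foldV x ≡ v
  foldV-surjective v = fromℕ< v<N , toℕ-injective (begin
      toℕ (foldV (fromℕ< v<N))   ≡⟨ toℕ-foldV (fromℕ< v<N) ⟩
      fold (toℕ (fromℕ< v<N))    ≡⟨ cong fold (toℕ-fromℕ< v<N) ⟩
      fold (toℕ v)               ≡⟨ fold-lower (toℕ<n v) ⟩
      toℕ v                      ∎)
    where
    open ≡-Reasoning
    v<N : toℕ v < N
    v<N = <-trans (toℕ<n v) m<N

  foldE-surjective : ∀ h → ∃ λ j → foldE j ≡ h
  foldE-surjective h = fromℕ< p<N , position-injective _ h (begin
      position (foldE (fromℕ< p<N))    ≡⟨ position-foldE (fromℕ< p<N) ⟩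
      foldEdge (toℕ (fromℕ< p<N))      ≡⟨ cong foldEdge (toℕ-fromℕ< p<N) ⟩
      foldEdge (position h)            ≡⟨ foldEdge-lower (position≤ h) ⟩
      position h                       ∎)
    where
    open ≡-Reasoning
    p<N : position h < N
    p<N = ≤-<-trans (position≤ h) m<N

  foldE-incid : ∀ j → Incid foldV (cycEdge (k + k) j) (pathEdge k (foldE j))
  foldE-incid j = Incid-cycEdge foldV j _ (Incid-into-pathEdge foldV (prev j) j (foldE j)
    (SameEndsᴺ-cong (sym (toℕ-foldV (prev j))) (trans (cong fold (sym toℕ-j)) (sym (toℕ-foldV j)))
                    (cong pred (sym position≡)) (cong (_⊓ k) (sym position≡))
                    (edge-ends (toℕ (prev j)) (toℕ<n (prev j)))))
    where
    toℕ-j : toℕ j ≡ suc (toℕ (prev j)) % N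
    toℕ-j = trans (cong toℕ (sym (next-prev j))) (toℕ-next (prev j))
    position≡ : position (foldE j) ≡ foldEdge (suc (toℕ (prev j)) % N)
    position≡ = trans (position-foldE j) (cong foldEdge toℕ-j)

  foldE-localBij : LocalBij (C N) (P̃ m) foldV foldE
  foldE-localBij x h = begin
      ∑[ e < N ] δ (foldE e) h (endsAt (cycEdge (k + k) e) x)
    ≡⟨ ∑δ-endsAt-cycEdge foldE x h ⟩
      [ foldE (next x) ≡? h ] + [ foldE x ≡? h ]
    ≡⟨ cong₂ _+_ ([edgeAt≡?] _ (foldEdge≤m (toℕ (next x))) h) ([edgeAt≡?] _ (foldEdge≤m (toℕ x)) h)
     ⟩
      [ foldEdge (toℕ (next x)) ≡ᴺ? p ] + [ foldEdge (toℕ x) ≡ᴺ? p ]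
    ≡⟨ cong (λ z → [ foldEdge z ≡ᴺ? p ] + [ foldEdge (toℕ x) ≡ᴺ? p ]) (toℕ-next x) ⟩
      [ foldEdge (suc (toℕ x) % N) ≡ᴺ? p ] + [ foldEdge (toℕ x) ≡ᴺ? p ]
    ≡⟨ SameEndsᴺ-[≡ᴺ?] (edges-around (toℕ x) (toℕ<n x)) p ⟩
      [ fold (toℕ x) ≡ᴺ? p ] + [ suc (fold (toℕ x)) ≡ᴺ? p ]
    ≡⟨ cong₂ _+_ ([≡ᴺ?]-sym (fold (toℕ x)) p) ([≡ᴺ?]-sym (suc (fold (toℕ x))) p) ⟩
      [ p ≡ᴺ? fold (toℕ x) ] + [ p ≡ᴺ? suc (fold (toℕ x)) ]
    ≡⟨ cong (λ z → [ p ≡ᴺ? z ] + [ p ≡ᴺ? suc z ]) (toℕ-foldV x) ⟨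
      [ p ≡ᴺ? toℕ (foldV x) ] + [ p ≡ᴺ? suc (toℕ (foldV x)) ]
    ≡⟨ endsAt-pathEdge h (foldV x) ⟨
      endsAt (pathEdge k h) (foldV x)
    ∎
    where
    open ≡-Reasoning
    p = position h

  covering-fold : Covering (C N) (P̃ m)
  covering-fold = covering foldV foldE foldV-surjective foldE-surjective foldE-incid foldE-localBij

-- Two-colouring by two fixed-point-free involutions

minUpTo : ℕ → (ℕ → ℕ) → ℕ
minUpTo zero    f = f 0
minUpTo (suc b) f = minUpTo b f ⊓ f (suc b)

minUpTo≤ : ∀ b f j → j ≤ b → minUpTo b f ≤ f j
minUpTo≤ zero    f zero _ = ≤-refl
minUpTo≤ (suc b) f j j≤1+b with m≤n⇒m<n∨m≡n j≤1+b
... | inj₁ j<1+b = ≤-trans (m⊓n≤m _ _) (minUpTo≤ b f j (s≤s⁻¹ j<1+b))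
... | inj₂ refl  = m⊓n≤n _ _

minUpTo-attained : ∀ b f → ∃ λ j → minUpTo b f ≡ f j
minUpTo-attained zero    f = 0 , refl
minUpTo-attained (suc b) f with ⊓-sel (minUpTo b f) (f (suc b))
... | inj₁ eq = proj₁ (minUpTo-attained b f) , trans eq (proj₂ (minUpTo-attained b f))
... | inj₂ eq = suc b , eq

even-or-odd : ∀ K → ∃ λ j → K ≡ j + j ⊎ K ≡ suc (j + j)
even-or-odd zero = 0 , inj₁ refl
even-or-odd (suc K) with even-or-odd K
... | j , inj₁ eq = j , inj₂ (cong suc eq)
... | j , inj₂ eq = suc j , inj₁ (trans (cong suc eq) (cong suc (sym (+-suc j j))))

-- With ρ = β ∘ α, the points x and α x lie in different ρ-orbits: otherwise α x = ρ^K x, and as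
-- α ρ^j α = ρ^-j, according to the parity of K either α or β has a fixed point.  A point is
-- coloured by which of the two orbits has the smaller least element.
module InvolutionColouring (n : ℕ) (α β : Fin n → Fin n)
  (α-involutive : ∀ x → α (α x) ≡ x) (β-involutive : ∀ x → β (β x) ≡ x)
  (α-fixpoint-free : ∀ x → α x ≢ x) (β-fixpoint-free : ∀ x → β x ≢ x) where

  ρ : Fin n → Fin n
  ρ x = β (α x)

  ρ^ : ℕ → Fin n → Fin n
  ρ^ zero    x = x
  ρ^ (suc j) x = ρ^ j (ρ x)

  ρ^-ρ : ∀ j x → ρ^ j (ρ x) ≡ ρ (ρ^ j x)
  ρ^-ρ zero    x = refl
  ρ^-ρ (suc j) x = ρ^-ρ j (ρ x)

  ρ^-+ : ∀ a b x → ρ^ (a + b) x ≡ ρ^ a (ρ^ b x)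
  ρ^-+ zero    b x = refl
  ρ^-+ (suc a) b x = trans (ρ^-+ a b (ρ x)) (cong (ρ^ a) (ρ^-ρ b x))

  ρ-injective : ∀ {a b} → ρ a ≡ ρ b → a ≡ b
  ρ-injective {a} {b} eq = begin
    a             ≡⟨ α-involutive a ⟨
    α (α a)       ≡⟨ cong α (β-involutive (α a)) ⟨
    α (β (ρ a))   ≡⟨ cong (α ∘ β) eq ⟩
    α (β (ρ b))   ≡⟨ cong α (β-involutive (α b)) ⟩
    α (α b)       ≡⟨ α-involutive b ⟩
    b             ∎
    where open ≡-Reasoning

  ρ^-injective : ∀ j {a b} → ρ^ j a ≡ ρ^ j b → a ≡ b
  ρ^-injective zero    eq = eq
  ρ^-injective (suc j) eq = ρ-injective (ρ^-injective j eq)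

  ρ^-periodic : ∀ p x → ρ^ p x ≡ x → ∀ q → ρ^ (q * p) x ≡ x
  ρ^-periodic p x eq zero    = refl
  ρ^-periodic p x eq (suc q) = trans (ρ^-+ p (q * p) x) (trans (cong (ρ^ p) (ρ^-periodic p x eq q)) eq)

  period : ∀ x → ∃ λ p → suc p ≤ n × ρ^ (suc p) x ≡ x
  period x with pigeonhole (n<1+n n) (λ (i : Fin (suc n)) → ρ^ (toℕ i) x)
  ... | i , j , i<j , eq = p , 1+p≤n , ρ^-injective (toℕ i) shifted
    where
    p = toℕ j ∸ suc (toℕ i)
    1+p+i≡j : suc p + toℕ i ≡ toℕ j
    1+p+i≡j = trans (cong (_+ toℕ i) (sym (+-∸-assoc 1 i<j))) (m∸n+n≡m (<⇒≤ i<j))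
    1+p≤n : suc p ≤ n
    1+p≤n = ≤-trans (m≤m+n (suc p) (toℕ i)) (≤-trans (≤-reflexive 1+p+i≡j) (s≤s⁻¹ (toℕ<n j)))
    shifted : ρ^ (toℕ i) (ρ^ (suc p) x) ≡ ρ^ (toℕ i) x
    shifted = trans (sym (ρ^-+ (toℕ i) (suc p) x))
                    (trans (cong (λ z → ρ^ z x) (trans (+-comm (toℕ i) (suc p)) 1+p+i≡j)) (sym eq))

  ρ^-bounded : ∀ x j → ∃ λ j′ → j′ ≤ n × ρ^ j x ≡ ρ^ j′ x
  ρ^-bounded x j with period x
  ... | p , 1+p≤n , ρ^[1+p]x≡x = r , ≤-trans (<⇒≤ (m%n<n j (suc p))) 1+p≤n , (begin
      ρ^ j x                        ≡⟨ cong (λ z → ρ^ z x) (m≡m%n+[m/n]*n j (suc p)) ⟩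
      ρ^ (r + q * suc p) x          ≡⟨ ρ^-+ r (q * suc p) x ⟩
      ρ^ r (ρ^ (q * suc p) x)       ≡⟨ cong (ρ^ r) (ρ^-periodic (suc p) x ρ^[1+p]x≡x q) ⟩
      ρ^ r x                        ∎)
    where
    open ≡-Reasoning
    r = j % suc p
    q = j / suc p

  orbitMin : Fin n → ℕ
  orbitMin x = minUpTo n (λ j → toℕ (ρ^ j x))

  orbitMin≤ : ∀ x j → orbitMin x ≤ toℕ (ρ^ j x)
  orbitMin≤ x j with ρ^-bounded x j
  ... | j′ , j′≤n , eq =
    subst (orbitMin x ≤_) (cong toℕ (sym eq)) (minUpTo≤ n (λ j → toℕ (ρ^ j x)) j′ j′≤n)

  orbitMin-attained : ∀ x → ∃ λ a → orbitMin x ≡ toℕ (ρ^ a x)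
  orbitMin-attained x = minUpTo-attained n (λ j → toℕ (ρ^ j x))

  orbitMin-ρ : ∀ x → orbitMin (ρ x) ≡ orbitMin x
  orbitMin-ρ x with period x | orbitMin-attained x | orbitMin-attained (ρ x)
  ... | p , _ , ρ^[1+p]x≡x | a , min≡ | b , minρ≡ = ≤-antisym
    (subst (orbitMin (ρ x) ≤_) (sym (trans min≡ (cong toℕ back))) (orbitMin≤ (ρ x) (a + p)))
    (subst (orbitMin x ≤_) (sym minρ≡) (orbitMin≤ x (suc b)))
    where
    back : ρ^ a x ≡ ρ^ (suc (a + p)) x
    back = sym (begin
      ρ^ (suc (a + p)) x        ≡⟨ cong (λ z → ρ^ z x) (+-suc a p) ⟨
      ρ^ (a + suc p) x          ≡⟨ ρ^-+ a (suc p) x ⟩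
      ρ^ a (ρ^ (suc p) x)       ≡⟨ cong (ρ^ a) ρ^[1+p]x≡x ⟩
      ρ^ a x                    ∎)
      where open ≡-Reasoning

  α-ρ^-α-ρ^ : ∀ j z → α (ρ^ j (α (ρ^ j z))) ≡ z
  α-ρ^-α-ρ^ zero    z = α-involutive z
  α-ρ^-α-ρ^ (suc j) z = begin
      α (ρ^ j (ρ (α (ρ^ j (ρ z)))))   ≡⟨ cong (λ w → α (ρ^ j (ρ (α w)))) (ρ^-ρ j z) ⟩
      α (ρ^ j (ρ (α (ρ (ρ^ j z)))))   ≡⟨ cong (λ w → α (ρ^ j w)) (ρ-α-ρ (ρ^ j z)) ⟩
      α (ρ^ j (α (ρ^ j z)))           ≡⟨ α-ρ^-α-ρ^ j z ⟩
      z                               ∎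
    where
    open ≡-Reasoning
    ρ-α-ρ : ∀ w → ρ (α (ρ w)) ≡ α w
    ρ-α-ρ w = trans (cong β (α-involutive (β (α w)))) (β-involutive (α w))

  α≢ρ^ : ∀ K x → α x ≢ ρ^ K x
  α≢ρ^ K x αx≡ with even-or-odd K
  ... | j , inj₁ refl = α-fixpoint-free y (begin
      α (ρ^ j x)                      ≡⟨ cong (λ w → α (ρ^ j w)) (α-involutive x) ⟨
      α (ρ^ j (α (α x)))              ≡⟨ cong (λ w → α (ρ^ j (α w))) (trans αx≡ (ρ^-+ j j x)) ⟩
      α (ρ^ j (α (ρ^ j y)))           ≡⟨ α-ρ^-α-ρ^ j y ⟩
      y                               ∎)
    where
    open ≡-Reasoning
    y = ρ^ j x
  ... | j , inj₂ refl = β-fixpoint-free (α y) (begin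
      β (α y)                         ≡⟨ ρ^-ρ j x ⟨
      u                               ≡⟨ α-involutive u ⟨
      α (α u)                         ≡⟨ cong α αu≡y ⟩
      α y                             ∎)
    where
    open ≡-Reasoning
    y = ρ^ j x
    u = ρ^ (suc j) x
    αu≡y : α u ≡ y
    αu≡y = begin
      α (ρ^ (suc j) x)                ≡⟨ cong (λ w → α (ρ^ (suc j) w)) (α-involutive x) ⟨
      α (ρ^ (suc j) (α (α x)))        ≡⟨ cong (λ w → α (ρ^ (suc j) (α w))) (trans αx≡ (ρ^-+ (suc j) j x)) ⟩
      α (ρ^ (suc j) (α (ρ^ (suc j) y))) ≡⟨ α-ρ^-α-ρ^ (suc j) y ⟩
      y                               ∎

  orbitMin-α≢ : ∀ x → orbitMin x ≢ orbitMin (α x)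
  orbitMin-α≢ x eq with orbitMin-attained x | orbitMin-attained (α x) | period (α x)
  ... | a , min≡ | b , minα≡ | q , _ , ρ^[1+q]αx≡αx = α≢ρ^ (q * b + a) x (sym (begin
      ρ^ (q * b + a) x                ≡⟨ ρ^-+ (q * b) a x ⟩
      ρ^ (q * b) (ρ^ a x)             ≡⟨ cong (ρ^ (q * b)) ρ^ax≡ρ^bαx ⟩
      ρ^ (q * b) (ρ^ b (α x))         ≡⟨ ρ^-+ (q * b) b (α x) ⟨
      ρ^ (q * b + b) (α x)            ≡⟨ cong (λ z → ρ^ z (α x)) (trans (+-comm (q * b) b) (*-comm (suc q) b)) ⟩
      ρ^ (b * suc q) (α x)            ≡⟨ ρ^-periodic (suc q) (α x) ρ^[1+q]αx≡αx b ⟩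
      α x                             ∎))
    where
    open ≡-Reasoning
    ρ^ax≡ρ^bαx : ρ^ a x ≡ ρ^ b (α x)
    ρ^ax≡ρ^bαx = toℕ-injective (trans (sym min≡) (trans eq minα≡))

  colour : Fin n → Bool
  colour x = ⌊ orbitMin x <? orbitMin (α x) ⌋

  colour-α : ∀ x → colour (α x) ≡ not (colour x)
  colour-α x =
    trans (cong (λ z → ⌊ orbitMin (α x) <? orbitMin z ⌋) (α-involutive x)) (<?-flip (orbitMin-α≢ x))
    where
    <?-flip : ∀ {a b} → a ≢ b → ⌊ b <? a ⌋ ≡ not ⌊ a <? b ⌋
    <?-flip {a} {b} a≢b with a <? b | b <? a
    ... | yes a<b | yes b<a = ⊥-elim (<-asym a<b b<a)
    ... | yes _   | no _    = refl
    ... | no _    | yes _   = refl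
    ... | no a≮b  | no b≮a  = ⊥-elim (a≢b (≤-antisym (≮⇒≥ b≮a) (≮⇒≥ a≮b)))

  colour-β : ∀ x → colour (β x) ≡ not (colour x)
  colour-β x = trans (cong₂ (λ a b → ⌊ a <? b ⌋) min-βx min-αβx) (colour-α x)
    where
    min-βx : orbitMin (β x) ≡ orbitMin (α x)
    min-βx = trans (cong (λ z → orbitMin (β z)) (sym (α-involutive x))) (orbitMin-ρ (α x))
    min-αβx : orbitMin (α (β x)) ≡ orbitMin (α (α x))
    min-αβx = trans (sym (orbitMin-ρ (α (β x)))) (cong orbitMin ραβx≡ααx)
      where
      ραβx≡ααx : ρ (α (β x)) ≡ α (α x)
      ραβx≡ααx = trans (cong β (α-involutive (β x))) (trans (β-involutive x) (sym (α-involutive x)))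

-- Lifting coverings of P̃ m to C 2m

module Ends {G : Graph} (simple : Simple G) where
  src tgt : Fin (nE G) → Fin (nV G)
  src e = proj₁ (Simple.all-normal simple e)
  tgt e = proj₁ (proj₂ (Simple.all-normal simple e))

  edge≡ : ∀ e → edge G e ≡ normal (src e) (tgt e)
  edge≡ e = proj₂ (proj₂ (Simple.all-normal simple e))

  src≢tgt : ∀ e → src e ≢ tgt e
  src≢tgt e = normal-distinct G e (src e) (tgt e) (edge≡ e)

  _∈ends_ : Fin (nV G) → Fin (nE G) → Set
  x ∈ends e = 1 ≤ endsAt (edge G e) x

  ∈ends⁻ : ∀ {e x} → x ∈ends e → src e ≡ x ⊎ tgt e ≡ x
  ∈ends⁻ {e} {x} p = endsAt-normal⁻ (src e) (tgt e) x (subst (λ s → 1 ≤ endsAt s x) (edge≡ e) p)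

  ∈ends⁺ : ∀ {e x} → src e ≡ x ⊎ tgt e ≡ x → x ∈ends e
  ∈ends⁺ {e} {x} p = subst (λ s → 1 ≤ endsAt s x) (sym (edge≡ e)) (endsAt-normal⁺ p)

  other : Fin (nE G) → Fin (nV G) → Fin (nV G)
  other e x = if ⌊ src e ≟ x ⌋ then tgt e else src e

  other-SameEnds : ∀ {e x} → x ∈ends e → SameEnds x (other e x) (src e) (tgt e)
  other-SameEnds {e} {x} p with src e ≟ x | ∈ends⁻ p
  ... | yes src≡x | _          = inj₁ (sym src≡x , refl)
  ... | no src≢x  | inj₁ src≡x = ⊥-elim (src≢x src≡x)
  ... | no _      | inj₂ tgt≡x = inj₂ (sym tgt≡x , refl)

  other-∈ends : ∀ {e x} → x ∈ends e → other e x ∈ends e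
  other-∈ends p with other-SameEnds p
  ... | inj₁ (_ , other≡tgt) = ∈ends⁺ (inj₂ (sym other≡tgt))
  ... | inj₂ (_ , other≡src) = ∈ends⁺ (inj₁ (sym other≡src))

  other-≢ : ∀ {e x} → x ∈ends e → other e x ≢ x
  other-≢ {e} p other≡x with other-SameEnds p
  ... | inj₁ (x≡src , other≡tgt) = src≢tgt e (trans (sym x≡src) (trans (sym other≡x) other≡tgt))
  ... | inj₂ (x≡tgt , other≡src) = src≢tgt e (trans (sym other≡src) (trans other≡x x≡tgt))

  other-involutive : ∀ {e x} → x ∈ends e → other e (other e x) ≡ x
  other-involutive {e} p with other-SameEnds p | other-SameEnds (other-∈ends p)
  ... | inj₁ (_ , o≡tgt) | inj₁ (o≡src , _)  = ⊥-elim (src≢tgt e (trans (sym o≡src) o≡tgt))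
  ... | inj₁ (x≡src , _) | inj₂ (_ , oo≡src) = trans oo≡src (sym x≡src)
  ... | inj₂ (x≡tgt , _) | inj₁ (_ , oo≡tgt) = trans oo≡tgt (sym x≡tgt)
  ... | inj₂ (_ , o≡src) | inj₂ (o≡tgt , _)  = ⊥-elim (src≢tgt e (trans (sym o≡src) o≡tgt))

  other-src : ∀ e → other e (src e) ≡ tgt e
  other-src e with src e ≟ src e
  ... | yes _ = refl
  ... | no src≢src = ⊥-elim (src≢src refl)

even : ℕ → Bool
even zero    = true
even (suc n) = not (even n)

[≡ᴺ?]+[≡ᴺ?suc]≤1 : ∀ p t → [ p ≡ᴺ? t ] + [ p ≡ᴺ? suc t ] ≤ 1
[≡ᴺ?]+[≡ᴺ?suc]≤1 p t with p ≟ℕ t | p ≟ℕ suc t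
... | yes refl | yes p≡1+p = ⊥-elim (1+n≢n (sym p≡1+p))
... | yes _    | no _      = ≤-refl
... | no _     | yes _     = ≤-refl
... | no _     | no _      = z≤n

[≡ᴺ?]+[≡ᴺ?suc]-positive : ∀ p t → 1 ≤ [ p ≡ᴺ? t ] + [ p ≡ᴺ? suc t ] → p ≡ t ⊎ p ≡ suc t
[≡ᴺ?]+[≡ᴺ?suc]-positive p t q with p ≟ℕ t | p ≟ℕ suc t
... | yes p≡t | _         = inj₁ p≡t
... | no _    | yes p≡1+t = inj₂ p≡1+t
... | no _    | no _      = ⊥-elim (1+n≰n q)

module PathParity (k : ℕ) where
  open Path k

  pick : Bool → ℕ → ℕ
  pick true  t = if even t then t else suc t
  pick false t = if even t then suc t else t

  pick-cases : ∀ b t → pick b t ≡ t ⊎ pick b t ≡ suc t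
  pick-cases true  t with even t
  ... | true  = inj₁ refl
  ... | false = inj₂ refl
  pick-cases false t with even t
  ... | true  = inj₂ refl
  ... | false = inj₁ refl

  even-pick : ∀ b t → even (pick b t) ≡ b
  even-pick true  t with even t in eq
  ... | true  = eq
  ... | false = cong not eq
  even-pick false t with even t in eq
  ... | true  = cong not eq
  ... | false = eq

  pick≤ : ∀ b t → t < suc k → pick b t ≤ suc k
  pick≤ b t t<m with pick-cases b t
  ... | inj₁ eq = subst (_≤ suc k) (sym eq) (<⇒≤ t<m)
  ... | inj₂ eq = subst (_≤ suc k) (sym eq) t<m

  -- Vertex v lies on the path edges at positions v and v + 1, one of each parity.
  edgeOfParity : Bool → Fin (suc k) → Fin (suc (suc k))
  edgeOfParity b v = edgeAt (pick b (toℕ v)) (pick≤ b (toℕ v) (toℕ<n v))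

  position-edgeOfParity : ∀ b v → position (edgeOfParity b v) ≡ pick b (toℕ v)
  position-edgeOfParity b v = position-edgeAt _ _

  P̃-loopless : ∀ h v → endsAt (pathEdge k h) v ≤ 1
  P̃-loopless h v = subst (_≤ 1) (sym (endsAt-pathEdge h v)) ([≡ᴺ?]+[≡ᴺ?suc]≤1 (position h) (toℕ v))

  edgeOfParity-at : ∀ b v → 1 ≤ endsAt (pathEdge k (edgeOfParity b v)) v
  edgeOfParity-at b v = subst (1 ≤_) (sym (endsAt-pathEdge (edgeOfParity b v) v))
    (subst (λ p → 1 ≤ [ p ≡ᴺ? toℕ v ] + [ p ≡ᴺ? suc (toℕ v) ]) (sym (position-edgeOfParity b v))
      (at (pick-cases b (toℕ v))))
    where
    at : ∀ {p} → p ≡ toℕ v ⊎ p ≡ suc (toℕ v) → 1 ≤ [ p ≡ᴺ? toℕ v ] + [ p ≡ᴺ? suc (toℕ v) ]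
    at {p} (inj₁ refl) with p ≟ℕ p
    ... | yes _   = s≤s z≤n
    ... | no p≢p  = ⊥-elim (p≢p refl)
    at {p} (inj₂ refl) with p ≟ℕ p
    ... | yes _   = m≤n+m 1 _
    ... | no p≢p  = ⊥-elim (p≢p refl)

  edgeOfParity-unique : ∀ h v b → 1 ≤ endsAt (pathEdge k h) v → even (position h) ≡ b →
                        h ≡ edgeOfParity b v
  edgeOfParity-unique h v b p even≡b = position-injective h (edgeOfParity b v)
    (trans (same (position h) (pick b (toℕ v)) at-v (pick-cases b (toℕ v))
                 (trans even≡b (sym (even-pick b (toℕ v)))))
           (sym (position-edgeOfParity b v)))
    where
    at-v : position h ≡ toℕ v ⊎ position h ≡ suc (toℕ v)
    at-v = [≡ᴺ?]+[≡ᴺ?suc]-positive (position h) (toℕ v) (subst (1 ≤_) (endsAt-pathEdge h v) p)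
    same : ∀ p q {t} → p ≡ t ⊎ p ≡ suc t → q ≡ t ⊎ q ≡ suc t → even p ≡ even q → p ≡ q
    same p q (inj₁ refl) (inj₁ refl) _  = refl
    same p q (inj₂ refl) (inj₂ refl) _  = refl
    same p q (inj₁ refl) (inj₂ refl) eq = ⊥-elim (not-¬ refl eq)
    same p q (inj₂ refl) (inj₁ refl) eq = ⊥-elim (not-¬ refl (sym eq))

module ParityWalk (k : ℕ) {G : Graph} (simple : Simple G) (π : Covering G (P̃ (suc k))) where
  open Ends simple
  open Path k
  open PathParity k
  module π = Covering π

  over-end : ∀ {e x} → x ∈ends e → 1 ≤ endsAt (pathEdge k (π.fE e)) (π.fV x)
  over-end {e} {x} = endsAt-Incid π.fV (edge G e) _ x (π.incid e)

  private
    lifted : ∀ b x → ∃ λ e → π.fE e ≡ edgeOfParity b (π.fV x) × 1 ≤ endsAt (edge G e) x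
    lifted b x = LocalBij-lift-edge {G} {P̃ (suc k)} (localBij π) x _ (edgeOfParity-at b (π.fV x))

  edgeOver : Bool → Fin (nV G) → Fin (nE G)
  edgeOver b x = proj₁ (lifted b x)

  edgeOver-∈ends : ∀ b x → x ∈ends edgeOver b x
  edgeOver-∈ends b x = proj₂ (proj₂ (lifted b x))

  edgeOver-parity : ∀ b x → even (position (π.fE (edgeOver b x))) ≡ b
  edgeOver-parity b x = trans (cong (λ h → even (position h)) (proj₁ (proj₂ (lifted b x))))
                              (trans (cong even (position-edgeOfParity b (π.fV x))) (even-pick b _))

  edgeOver-unique : ∀ b x e → x ∈ends e → even (position (π.fE e)) ≡ b → edgeOver b x ≡ e
  edgeOver-unique b x e x∈e parity≡b =
    LocalBij-unique-edge {G} {P̃ (suc k)} (localBij π) x h (P̃-loopless h (π.fV x)) (edgeOver b x) e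
      (proj₁ (proj₂ (lifted b x))) (edgeOver-∈ends b x)
      (edgeOfParity-unique (π.fE e) (π.fV x) b (over-end x∈e) parity≡b) x∈e
    where
    h = edgeOfParity b (π.fV x)

  -- The edges over even, resp. odd, positions form a perfect matching; walk b follows it.
  walk : Bool → Fin (nV G) → Fin (nV G)
  walk b x = other (edgeOver b x) x

  walk-involutive : ∀ b x → walk b (walk b x) ≡ x
  walk-involutive b x =
    trans (cong (λ e′ → other e′ (walk b x)) same-edge) (other-involutive (edgeOver-∈ends b x))
    where
    same-edge : edgeOver b (walk b x) ≡ edgeOver b x
    same-edge = edgeOver-unique b (walk b x) (edgeOver b x) (other-∈ends (edgeOver-∈ends b x)) (edgeOver-parity b x)

  walk-≢ : ∀ b x → walk b x ≢ x
  walk-≢ b x = other-≢ (edgeOver-∈ends b x)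

  private
    module Colouring = InvolutionColouring (nV G) (walk true) (walk false)
      (walk-involutive true) (walk-involutive false) (walk-≢ true) (walk-≢ false)

  colour : Fin (nV G) → Bool
  colour = Colouring.colour

  colour-walk : ∀ b x → colour (walk b x) ≡ not (colour x)
  colour-walk true  = Colouring.colour-α
  colour-walk false = Colouring.colour-β

  colour-other : ∀ {e x} → x ∈ends e → colour (other e x) ≡ not (colour x)
  colour-other {e} {x} x∈e =
    trans (cong (λ e′ → colour (other e′ x)) (sym (edgeOver-unique b x e x∈e refl))) (colour-walk b x)
    where
    b = even (position (π.fE e))

even-flip : ∀ {a b t} → SameEndsᴺ a b t (suc t) → even b ≡ not (even a)
even-flip (inj₁ (refl , refl)) = refl
even-flip (inj₂ (refl , refl)) = sym (not-involutive _)

toℕ-SameEnds : ∀ {k} {va vb : Fin (suc k)} i → SameEnds va vb (inject₁ i) (suc i) →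
               SameEndsᴺ (toℕ va) (toℕ vb) (toℕ i) (suc (toℕ i))
toℕ-SameEnds i (inj₁ (p , q)) = inj₁ (trans (cong toℕ p) (toℕ-inject₁ i) , cong toℕ q)
toℕ-SameEnds i (inj₂ (p , q)) = inj₂ (cong toℕ p , trans (cong toℕ q) (toℕ-inject₁ i))

module Unfold (k : ℕ) where
  open FoldArithmetic k
  open Path k

  unfold-ends : ∀ h {va vb : Fin (suc k)} {sa sb} → Incid id (normal va vb) (pathEdge k h) →
    (toℕ va ≡ toℕ vb → sb ≡ not sa) → (even (toℕ vb) ≡ not (even (toℕ va)) → sb ≡ sa) →
    SameEndsᴺ (unfold (toℕ va) sa) (unfold (toℕ vb) sb)
              (prevᴺ (unfoldEdge (position h) sa)) (unfoldEdge (position h) sa)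
  unfold-ends zero {sa = sa} (refl , refl) swap _ rewrite swap refl = unfold-semi₀ sa
  unfold-ends (suc zero) {sa = sa} (refl , refl) swap _ rewrite swap refl | toℕ-fromℕ k = unfold-semiₘ sa
  unfold-ends (suc (suc i)) {va} {vb} {sa} ends _ keep
    rewrite keep (even-flip (toℕ-SameEnds i ends)) = unfold-inner (toℕ<n i) (toℕ-SameEnds i ends) sa

module Lift (k : ℕ) {G : Graph} (simple : Simple G) (π : Covering G (P̃ (suc k))) where
  open FoldArithmetic k
  open Cycle (k + k) hiding (N)
  open Path k
  open Fold k
  open Ends simple
  open ParityWalk k simple π using (colour; colour-other)
  open PathParity k using (P̃-loopless)
  open Unfold k
  module π = Covering π

  -- An edge over a normal path edge joins different colours over vertices of different parity,
  -- so it keeps the sheet; an edge over a semi-edge joins different colours over one vertex,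
  -- so it swaps the sheet.  This is exactly how C 2m lies over P̃ m.
  sheet : Fin (nV G) → Bool
  sheet x = colour x xor even (toℕ (π.fV x))

  liftV : Fin (nV G) → Fin N
  liftV x = fromℕ< (unfold<N (sheet x) (toℕ<n (π.fV x)))

  liftE : Fin (nE G) → Fin N
  liftE e = fromℕ< (unfoldEdge<N (sheet (src e)) (position≤ (π.fE e)))

  toℕ-liftV : ∀ x → toℕ (liftV x) ≡ unfold (toℕ (π.fV x)) (sheet x)
  toℕ-liftV x = toℕ-fromℕ< _

  toℕ-liftE : ∀ e → toℕ (liftE e) ≡ unfoldEdge (position (π.fE e)) (sheet (src e))
  toℕ-liftE e = toℕ-fromℕ< _

  foldV-liftV : ∀ x → foldV (liftV x) ≡ π.fV x
  foldV-liftV x = toℕ-injective (begin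
      toℕ (foldV (liftV x))                    ≡⟨ toℕ-foldV (liftV x) ⟩
      fold (toℕ (liftV x))                     ≡⟨ cong fold (toℕ-liftV x) ⟩
      fold (unfold (toℕ (π.fV x)) (sheet x))   ≡⟨ fold-unfold (sheet x) (toℕ<n (π.fV x)) ⟩
      toℕ (π.fV x)                             ∎)
    where open ≡-Reasoning

  foldE-liftE : ∀ e → foldE (liftE e) ≡ π.fE e
  foldE-liftE e = position-injective _ _ (begin
      position (foldE (liftE e))                         ≡⟨ position-foldE (liftE e) ⟩
      foldEdge (toℕ (liftE e))                           ≡⟨ cong foldEdge (toℕ-liftE e) ⟩
      foldEdge (unfoldEdge (position h) (sheet (src e))) ≡⟨ foldEdge-unfoldEdge (sheet (src e)) (position≤ h) ⟩
      position h                                         ∎)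
    where
    open ≡-Reasoning
    h = π.fE e

  toℕ-prev : ∀ j → toℕ (prev j) ≡ prevᴺ (toℕ j)
  toℕ-prev zero    = toℕ-fromℕ (suc (k + k))
  toℕ-prev (suc i) = toℕ-inject₁ i

  colour-tgt : ∀ e → colour (tgt e) ≡ not (colour (src e))
  colour-tgt e = trans (cong colour (sym (other-src e))) (colour-other (∈ends⁺ (inj₁ refl)))

  liftE-incid : ∀ e → Incid liftV (edge G e) (cycEdge (k + k) (liftE e))
  liftE-incid e = subst (λ s → Incid liftV s (cycEdge (k + k) (liftE e))) (sym (edge≡ e))
    (Incid-into-cycEdge liftV a b (liftE e) (SameEndsᴺ-toℕ
      (SameEndsᴺ-cong (sym (toℕ-liftV a)) (sym (toℕ-liftV b))
                      (trans (cong prevᴺ (sym (toℕ-liftE e))) (sym (toℕ-prev (liftE e)))) (sym (toℕ-liftE e))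
        (unfold-ends (π.fE e) π-incid swap keep))))
    where
    a = src e
    b = tgt e
    π-incid : Incid id (normal (π.fV a) (π.fV b)) (pathEdge k (π.fE e))
    π-incid with pathEdge k (π.fE e) | subst (λ s → Incid π.fV s (pathEdge k (π.fE e))) (edge≡ e) (π.incid e)
    ... | normal _ _ | i = i
    ... | loop _     | i = i
    ... | semi _     | i = i
    sheet-b : sheet b ≡ not (colour a) xor even (toℕ (π.fV b))
    sheet-b = cong (_xor even (toℕ (π.fV b))) (colour-tgt e)
    swap : toℕ (π.fV a) ≡ toℕ (π.fV b) → sheet b ≡ not (sheet a)
    swap same = trans sheet-b (trans (cong (λ v → not (colour a) xor even v) (sym same))
                                     (sym (not-distribˡ-xor (colour a) _)))
    keep : even (toℕ (π.fV b)) ≡ not (even (toℕ (π.fV a))) → sheet b ≡ sheet a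
    keep flip = begin
      sheet b                                                   ≡⟨ sheet-b ⟩
      not (colour a) xor even (toℕ (π.fV b))                    ≡⟨ cong (not (colour a) xor_) flip ⟩
      not (colour a) xor not (even (toℕ (π.fV a)))              ≡⟨ not-distribˡ-xor (colour a) _ ⟨
      not (colour a xor not (even (toℕ (π.fV a))))              ≡⟨ cong not (not-distribʳ-xor (colour a) _) ⟨
      not (not (sheet a))                                       ≡⟨ not-involutive (sheet a) ⟩
      sheet a                                                   ∎
      where open ≡-Reasoning

  covering-lift : Covering G (C N)
  covering-lift = localBij⇒covering-C (k + k) simple (proj₁ (π.fV-surj zero)) liftV liftE liftE-incid
    (LocalBij-lift π covering-fold P̃-loopless liftV liftE foldV-liftV foldE-liftE liftE-incid)

covering⇒▷ : ∀ {A B} → Covering A B → A ▷ B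
covering⇒▷ c G _ cov = c ∘Cov cov

▷-trans : ∀ {A B D} → A ▷ B → B ▷ D → A ▷ D
▷-trans A▷B B▷D G simple cov = B▷D G simple (A▷B G simple cov)

C-cong : ∀ {a b} .{{_ : NonZero a}} .{{_ : NonZero b}} → a ≡ b → C a ≡ C b
C-cong refl = refl

nV-C : ∀ N .{{_ : NonZero N}} → nV (C N) ≡ N
nV-C 1             = refl
nV-C (suc (suc k)) = refl

2+[k+k]≡2*[1+k] : ∀ k → suc (suc (k + k)) ≡ 2 * suc k
2+[k+k]≡2*[1+k] k = cong suc (trans (sym (+-suc k k)) (cong (k +_) (sym (+-identityʳ (suc k)))))

∣⇒C▷C : ∀ n m .{{_ : NonZero n}} .{{_ : NonZero m}} → m ∣ n → C n ▷ C m
∣⇒C▷C n m m∣n = covering⇒▷ (C-covers-C n m m∣n)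

C[2m]-covers-P̃[m] : ∀ k → Covering (C (2 * suc k)) (P̃ (suc k))
C[2m]-covers-P̃[m] k = subst (λ X → Covering X (P̃ (suc k))) (C-cong (2+[k+k]≡2*[1+k] k)) (Fold.covering-fold k)

C[2m]▷P̃[m] : ∀ k → C (2 * suc k) ▷ P̃ (suc k)
C[2m]▷P̃[m] k = covering⇒▷ (C[2m]-covers-P̃[m] k)

P̃[m]▷C[2m] : ∀ k → P̃ (suc k) ▷ C (2 * suc k)
P̃[m]▷C[2m] k G simple π = subst (Covering G) (C-cong (2+[k+k]≡2*[1+k] k)) (Lift.covering-lift k simple π)

▷C⇒∣ : ∀ {A} N m .{{_ : NonZero N}} .{{_ : NonZero m}} → 3 ≤ N → Covering (C N) A → A ▷ C m → m ∣ N
▷C⇒∣ N m 3≤N cov A▷C = subst (m ∣_) (nV-C N) (covers-C⇒∣nV simple m (A▷C (C N) simple cov))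
  where simple = C-simple N 3≤N

▷P̃⇒2*∣ : ∀ {A} N m .{{_ : NonZero N}} .{{_ : NonZero m}} → 3 ≤ N → Covering (C N) A → A ▷ P̃ m → 2 * m ∣ N
▷P̃⇒2*∣ N m 3≤N cov A▷P̃ = subst (2 * m ∣_) (nV-C N) (covers-P̃⇒2*∣nV simple m (A▷P̃ (C N) simple cov))
  where simple = C-simple N 3≤N

∣m*[1+n]∧∣n⇒∣m : ∀ {d m n} → d ∣ m * suc n → d ∣ n → d ∣ m
∣m*[1+n]∧∣n⇒∣m {d} {m} {n} d∣m*[1+n] d∣n =
  ∣m+n∣m⇒∣n (subst (d ∣_) (trans (*-suc m n) (+-comm m (m * n))) d∣m*[1+n]) (∣n⇒∣m*n m d∣n)

3≤x*[1+2m] : ∀ x m .{{_ : NonZero x}} .{{_ : NonZero m}} → 3 ≤ x * suc (2 * m)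
3≤x*[1+2m] x m = ≤-trans (s≤s (*-monoʳ-≤ 2 (>-nonZero⁻¹ m))) (m≤n*m (suc (2 * m)) x)

C▷C⇒∣ : ∀ n m .{{_ : NonZero n}} .{{_ : NonZero m}} → C n ▷ C m → m ∣ n
C▷C⇒∣ n@(suc _) m C▷C = ∣m*[1+n]∧∣n⇒∣m (▷C⇒∣ N m (3≤x*[1+2m] n m) cover C▷C) (n∣m*n 2)
  where
  N = n * suc (2 * m)
  cover : Covering (C N) (C n)
  cover = C-covers-C N n (m∣m*n (suc (2 * m)))

C▷P̃⇒2*∣ : ∀ n m .{{_ : NonZero n}} .{{_ : NonZero m}} → C n ▷ P̃ m → 2 * m ∣ n
C▷P̃⇒2*∣ n@(suc _) m C▷P̃ = ∣m*[1+n]∧∣n⇒∣m (▷P̃⇒2*∣ N m (3≤x*[1+2m] n m) cover C▷P̃) ∣-refl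
  where
  N = n * suc (2 * m)
  cover : Covering (C N) (C n)
  cover = C-covers-C N n (m∣m*n (suc (2 * m)))

P̃▷C⇒∣2* : ∀ n m .{{_ : NonZero n}} .{{_ : NonZero m}} → P̃ n ▷ C m → m ∣ 2 * n
P̃▷C⇒∣2* n@(suc a) m P̃▷C = ∣m*[1+n]∧∣n⇒∣m (▷C⇒∣ N m (3≤x*[1+2m] (2 * n) m) cover P̃▷C) (n∣m*n 2)
  where
  N = 2 * n * suc (2 * m)
  cover : Covering (C N) (P̃ n)
  cover = C[2m]-covers-P̃[m] a ∘Cov C-covers-C N (2 * n) (m∣m*n (suc (2 * m)))

P̃▷P̃⇒∣ : ∀ n m .{{_ : NonZero n}} .{{_ : NonZero m}} → P̃ n ▷ P̃ m → m ∣ n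
P̃▷P̃⇒∣ n@(suc a) m P̃▷P̃ = ∣m*[1+n]∧∣n⇒∣m (*-cancelˡ-∣ 2 2m∣2*[n*[1+2m]]) (n∣m*n 2)
  where
  N = 2 * n * suc (2 * m)
  cover : Covering (C N) (P̃ n)
  cover = C[2m]-covers-P̃[m] a ∘Cov C-covers-C N (2 * n) (m∣m*n (suc (2 * m)))
  2m∣2*[n*[1+2m]] : 2 * m ∣ 2 * (n * suc (2 * m))
  2m∣2*[n*[1+2m]] = subst (2 * m ∣_) (*-assoc 2 n _) (▷P̃⇒2*∣ N m (3≤x*[1+2m] (2 * n) m) cover P̃▷P̃)

∣⇒P̃▷P̃ : ∀ n m .{{_ : NonZero n}} .{{_ : NonZero m}} → m ∣ n → P̃ n ▷ P̃ m
∣⇒P̃▷P̃ (suc a) (suc b) m∣n =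
  ▷-trans (P̃[m]▷C[2m] a) (▷-trans (∣⇒C▷C _ _ (*-monoʳ-∣ 2 m∣n)) (C[2m]▷P̃[m] b))

2*∣⇒C▷P̃ : ∀ n m .{{_ : NonZero n}} .{{_ : NonZero m}} → 2 * m ∣ n → C n ▷ P̃ m
2*∣⇒C▷P̃ n (suc b) 2m∣n = ▷-trans (∣⇒C▷C n _ 2m∣n) (C[2m]▷P̃[m] b)

∣2*⇒P̃▷C : ∀ n m .{{_ : NonZero n}} .{{_ : NonZero m}} → m ∣ 2 * n → P̃ n ▷ C m
∣2*⇒P̃▷C (suc a) m m∣2n = ▷-trans (P̃[m]▷C[2m] a) (∣⇒C▷C _ m m∣2n)

proposition5 : ∀ (n m : ℕ) .{{_ : NonZero n}} .{{_ : NonZero m}} →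
    ((C n ▷ C m) ⇔ (m ∣ n)) ×
    ((P̃ n ▷ P̃ m) ⇔ (m ∣ n)) ×
    ((C n ▷ P̃ m) ⇔ (2 * m ∣ n)) ×
    ((P̃ n ▷ C m) ⇔ (m ∣ 2 * n))
proposition5 n m =
  mk⇔ (C▷C⇒∣ n m) (∣⇒C▷C n m) ,
  mk⇔ (P̃▷P̃⇒∣ n m) (∣⇒P̃▷P̃ n m) ,
  mk⇔ (C▷P̃⇒2*∣ n m) (2*∣⇒C▷P̃ n m) ,
  mk⇔ (P̃▷C⇒∣2* n m) (∣2*⇒P̃▷C n m)
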